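{- Let $r,k,\ell$ be positive integers and let $G$ be a hypergraph on $n\geq k$ vertices all of whose edges have size at most $r$. Let $0<\varepsilon<1/2$ be a real number and let $B\subseteq V(G)$ be a subset with $|B|\leq k$; set $a=k-|B|$. Then there are at most \[2\cdot r^{1/4}\cdot \varepsilon^{ -1/2}\cdot k^{ -1/4}\cdot \frac{n^a}{a!}\] different sets $A\subseteq V(G)$ such that $(A,B)$ is an $\varepsilon$-pleasant pair.
   Context: A hypergraph has a finite vertex set and edges which are non-empty subsets of the vertex set. For $W\subseteq V(G)$, $e(W)$ is the number of edges $e\subseteq W$; a vertex $v\in W$ is non-isolated in $W$ if some edge $e\subseteq W$ contains $v$, and isolated in $W$ otherwise. For $B\subseteq V(G)$, a vertex $v\in V(G)\setminus B$ is connected to $B$ if there is an edge $e$ with $v\in e$ and $e\setminus\{v\}\subseteq B$. For $B\subseteq A\subseteq V(G)$: $h(A,B)$ is the number of $v\in A\setminus B$ connected to $B$; $m(A,B)$ is the number of $v\in A\setminus B$ non-isolated in $A$; $f(A,B)=m(A,B)-h(A,B)$. Given $k,\ell,r$ and $0<\varepsilon<1/2$, a pair $(A,B)$ with $B\subseteq A\subseteq V(G)$ is $\varepsilon$-pleasant if: (i) $|A|=k$ and $e(A)=\ell$; (ii) $f(A,B)=0$; (iii) $h(A,B)\geq \frac14 r^{ -1/2}\varepsilon\sqrt{k}$; (iv) $|A\setminus B|-h(A,B)\geq \frac14 r^{ -1/2}\varepsilon\sqrt{k}$.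
   Formalization: The parameter ε ranges over the rationals with $0<\varepsilon<1/2$ rather than over all real numbers. -}

module Defs where

open import Data.Nat as ℕ using (ℕ; _≤_; _^_; _*_; _!)
open import Data.Integer as ℤ using (ℤ; +_; _-_)
open import Data.Rational as ℚ using (ℚ; _/_)
open import Data.Fin using (Fin)
open import Data.Fin.Subset using (Subset; _∈_; _∉_; _⊆_; _─_; ⁅_⁆; ∣_∣; Nonempty)
open import Data.Fin.Subset.Properties using (_∈?_; _⊆?_)
open import Data.List using (List; length; filter; allFin)
open import Data.List.Relation.Unary.Any using (Any; any?)
open import Data.List.Relation.Unary.All using (All)
open import Data.List.Relation.Unary.Unique.Propositional using (Unique)
open import Data.Product using (_×_)
open import Relation.Nullary using (¬_)
open import Relation.Nullary.Decidable using (_×-dec_; ¬?)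
open import Relation.Binary.PropositionalEquality using (_≡_)

record Hypergraph (n : ℕ) : Set where
  field
    edges     : List (Subset n)
    unique    : Unique edges
    nonempty  : All Nonempty edges
open Hypergraph public

EdgesAtMost : ∀ {n} → ℕ → Hypergraph n → Set
EdgesAtMost r G = All (λ e → ∣ e ∣ ≤ r) (edges G)

module _ {n : ℕ} (G : Hypergraph n) where

  eCount : Subset n → ℕ
  eCount W = length (filter (_⊆? W) (edges G))

  NonIsolatedIn : Subset n → Fin n → Set
  NonIsolatedIn W v = Any (λ e → e ⊆ W × v ∈ e) (edges G)

  nonIsolatedIn? : ∀ W v → Relation.Nullary.Dec (NonIsolatedIn W v)
  nonIsolatedIn? W v = any? (λ e → (e ⊆? W) ×-dec (v ∈? e)) (edges G)

  ConnectedTo : Subset n → Fin n → Set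
  ConnectedTo B v = v ∉ B × Any (λ e → v ∈ e × (e ─ ⁅ v ⁆) ⊆ B) (edges G)

  connectedTo? : ∀ B v → Relation.Nullary.Dec (ConnectedTo B v)
  connectedTo? B v = ¬? (v ∈? B) ×-dec any? (λ e → (v ∈? e) ×-dec ((e ─ ⁅ v ⁆) ⊆? B)) (edges G)

  hFun : Subset n → Subset n → ℕ
  hFun A B = length (filter (λ v → (v ∈? (A ─ B)) ×-dec connectedTo? B v) (allFin n))

  mFun : Subset n → Subset n → ℕ
  mFun A B = length (filter (λ v → (v ∈? (A ─ B)) ×-dec nonIsolatedIn? A v) (allFin n))

  fFun : Subset n → Subset n → ℤ
  fFun A B = + mFun A B - + hFun A B

ℕ→ℚ : ℕ → ℚ
ℕ→ℚ m = + m / 1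

ℤ→ℚ : ℤ → ℚ
ℤ→ℚ z = z / 1

-- "x ≥ (1/4) r^(-1/2) ε √k" for real x, ε > 0, r, k > 0, written
-- without square roots:  x ≥ 0  and  16 r x² ≥ ε² k.
-- (Both sides of the original are compared after multiplying by 4√r > 0;
--  since the right-hand side is positive, x must be ≥ 0, and then squaring
--  is an equivalence.)
AtLeastQuarterEps : ℕ → ℕ → ℚ → ℚ → Set
AtLeastQuarterEps r k ε x =
  (ℚ.0ℚ ℚ.≤ x) × (ε ℚ.* ε ℚ.* ℕ→ℚ k ℚ.≤ ℕ→ℚ 16 ℚ.* ℕ→ℚ r ℚ.* (x ℚ.* x))

-- ε-pleasant pair (A,B) (B ⊆ A assumed as part of the notion)
Pleasant : ∀ {n} → Hypergraph n → (k ℓ r : ℕ) → ℚ → Subset n → Subset n → Set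
Pleasant G k ℓ r ε A B =
    B ⊆ A
  × ∣ A ∣ ≡ k × eCount G A ≡ ℓ
  × fFun G A B ≡ + 0
  × AtLeastQuarterEps r k ε (ℕ→ℚ (hFun G A B))
  × AtLeastQuarterEps r k ε (ℤ→ℚ (+ ∣ A ─ B ∣ - + hFun G A B))

-- "L ≤ 2 r^(1/4) ε^(-1/2) k^(-1/4) n^a / a!" written without roots
-- (all quantities positive, raise to the 4th power and clear denominators):
--   L⁴ · (a!)⁴ · ε² · k ≤ 16 · r · n^(4a)
BoundHolds : (L r k n a : ℕ) → ℚ → Set
BoundHolds L r k n a ε =
  ℕ→ℚ ((L * (a !)) ^ 4) ℚ.* (ε ℚ.* ε) ℚ.* ℕ→ℚ k ℚ.≤ ℕ→ℚ (16 * r * n ^ (4 * a))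

module Submission where

open import Defs
open import Data.Nat using (ℕ; zero; suc; _+_; _*_; _∸_; _≤_; _<_; z≤n; s≤s; _!; _^_; _⊓_; >-nonZero)
open import Data.Nat.Properties
open import Data.Nat.ListAction using (sum; product)
open import Data.Nat.ListAction.Properties using (sum-++; product-++)
open import Data.Nat.Tactic.RingSolver using (solve-∀)
open import Data.Nat.Coprimality using (1-coprimeTo) renaming (sym to coprime-sym)
open import Algebra.Properties.CommutativeSemigroup +-commutativeSemigroup using () renaming (interchange to +-interchange)
open import Algebra.Properties.CommutativeSemigroup *-commutativeSemigroup using (x∙yz≈y∙xz)
import Data.Integer as ℤ
import Data.Integer.Properties as ℤₚ
open import Data.Rational using (ℚ; 0ℚ; ½)
import Data.Rational as ℚ
import Data.Rational.Properties as ℚₚ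
open import Data.Bool using (true; if_then_else_)
open import Data.Fin using (Fin) renaming (_≟_ to _≟ᶠ_)
import Data.Fin as Fin
open import Data.Fin.Subset using (Subset; _∈_; _∉_; _⊆_; _─_; _∩_; _∪_; ∁; ⁅_⁆; ∣_∣; _-_; inside; outside)
open import Data.Fin.Subset.Properties
  using (_∈?_; _⊆?_; drop-there; ⊆-antisym; ⊆-reflexive; p⊂q⇒∣p∣<∣q∣; p⊆q⇒∣p∣≤∣q∣; p─q⊆p;
         x∈p∧x∉q⇒x∈p─q; x∈p∧x≢y⇒x∈p-y; x∈⁅x⁆; x∈⁅y⁆⇒x≡y; ∣⁅x⁆∣≡1; x∈p∩q⁺; x∈p∩q⁻;
         x∈p∪q⁺; x∈p∪q⁻; x∉p⇒x∈∁p; ∣∁p∣≡n∸∣p∣; ∣q∣≤∣p∪q∣; ∣p∣≤n)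
open import Data.Vec using ([]; _∷_; tabulate)
import Data.Vec as Vec
open import Data.Vec.Properties using (lookup∘tabulate; []=⇒lookup; lookup⇒[]=)
open import Data.List using (List; []; _∷_; length; filter; allFin; map; _++_; replicate)
import Data.List as List
open import Data.List.Properties using (filter-≐; filter-none; map-cong-local; map-∘; length-++; length-replicate)
open import Data.List.Extrema.Nat using (argmin; argmin-sel; f[argmin]≤f[⊤]; f[argmin]≤f[xs])
open import Data.List.Membership.Propositional using (find; lose) renaming (_∈_ to _∈ₗ_)
open import Data.List.Membership.Propositional.Properties using (∈-map⁻; ∈-filter⁻; ∈-allFin)
open import Data.List.Relation.Unary.Any as Any using (here; there)
open import Data.List.Relation.Unary.All as All using (All; []; _∷_)
import Data.List.Relation.Unary.All.Properties as All
open import Data.List.Relation.Unary.Unique.Propositional using (Unique; []; _∷_)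
open import Data.List.Relation.Unary.Unique.Propositional.Properties using (filter⁺)
open import Data.Product using (_×_; _,_; proj₁; proj₂; ∃)
open import Data.Sum using (_⊎_; inj₁; inj₂; [_,_])
open import Data.Unit using (⊤; tt)
open import Data.Empty using (⊥-elim)
open import Function using (_∘_; id; case_of_)
open import Relation.Nullary using (Dec; yes; no; does; ¬_)
open import Relation.Nullary.Decidable using (_×-dec_; dec-true)
open import Relation.Unary using (Pred; Decidable)
open import Relation.Binary.PropositionalEquality hiding ([_])

-- Let C be the vertices connected to B and D those outside B ∪ C.  A set A ⊇ B splits into B,
-- its connected part S A = A ∩ C (whose size is h(A,B)) and its remaining part T A = A ∖ (B ∪ C).
-- For pleasant A, f(A,B) = 0 forces every edge inside A into B ∪ S A; as e(A) = ℓ is fixed, the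
-- connected parts form an antichain, and the remaining parts sharing a connected part (all of
-- the same size) form an antichain as well.  A product LYM inequality, obtained from a weighted
-- LYM inequality proved by the usual double-counting induction, then bounds the sum over the
-- family of |S A|!(|C|-|S A|)! |T A|!(|D|-|T A|)! by |C|! |D|!.  Applying to the lightest
-- term the estimate binom(c,h) binom(d,t) (h+t)! √min(h,t) ≤ (c+d)^(h+t) (weighted AM-GM plus a
-- bound on the mode of a binomial distribution), and using that pleasantness makes both h and t
-- at least ¼ r^(-1/2) ε √k, gives the bound, which is stated without roots.

module _ {a p q} {A : Set a} {P : Pred A p} {Q : Pred A q} (P? : Decidable P) (Q? : Decidable Q) where

  count-mono : ∀ xs → (∀ {x} → x ∈ₗ xs → P x → Q x) → length (filter P? xs) ≤ length (filter Q? xs)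
  count-mono [] P⇒Q = z≤n
  count-mono (x ∷ xs) P⇒Q with P? x | Q? x | count-mono xs (P⇒Q ∘ there)
  ... | yes _  | yes _  | ih = s≤s ih
  ... | yes px | no ¬qx | _  = ⊥-elim (¬qx (P⇒Q (here refl) px))
  ... | no _   | yes _  | ih = m≤n⇒m≤1+n ih
  ... | no _   | no _   | ih = ih

  count-strict : ∀ xs → (∀ {x} → x ∈ₗ xs → P x → Q x) →
    ∀ {y} → y ∈ₗ xs → Q y → ¬ P y → length (filter P? xs) < length (filter Q? xs)
  count-strict (x ∷ xs) P⇒Q (here refl) qy ¬py with P? x | Q? x
  ... | yes px | _      = ⊥-elim (¬py px)
  ... | no _   | yes _  = s≤s (count-mono xs (P⇒Q ∘ there))
  ... | no _   | no ¬qy = ⊥-elim (¬qy qy)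
  count-strict (x ∷ xs) P⇒Q (there y∈xs) qy ¬py with P? x | Q? x | count-strict xs (P⇒Q ∘ there) y∈xs qy ¬py
  ... | yes _  | yes _  | ih = s≤s ih
  ... | yes px | no ¬qx | _  = ⊥-elim (¬qx (P⇒Q (here refl) px))
  ... | no _   | yes _  | ih = m≤n⇒m≤1+n ih
  ... | no _   | no _   | ih = ih

count-tabulate : ∀ {a b p} {A : Set a} {B : Set b} {P : Pred A p} (P? : Decidable P) {m}
  (f : B → A) (g : Fin m → B) →
  length (filter P? (List.tabulate (f ∘ g))) ≡ length (filter (P? ∘ f) (List.tabulate g))
count-tabulate P? {zero}  f g = refl
count-tabulate P? {suc m} f g with P? (f (g Fin.zero))
... | yes _ = cong suc (count-tabulate P? f (g ∘ Fin.suc))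
... | no _  = count-tabulate P? f (g ∘ Fin.suc)

size≡count : ∀ {n} (p : Subset n) → ∣ p ∣ ≡ length (filter (_∈? p) (allFin n))

size≡count-tail : ∀ {n} s (p : Subset n) → ∣ p ∣ ≡ length (filter (_∈? (s ∷ p)) (List.tabulate Fin.suc))

size≡count []                    = refl
size≡count {suc n} (inside ∷ p)  = cong suc (size≡count-tail inside p)
size≡count {suc n} (outside ∷ p) = size≡count-tail outside p

size≡count-tail {n} s p = begin
  ∣ p ∣                                                 ≡⟨ size≡count p ⟩
  length (filter (_∈? p) (allFin n))                    ≡⟨ cong length (filter-≐ (_∈? p) ((_∈? (s ∷ p)) ∘ Fin.suc)
                                                                           (Vec.there , drop-there) (allFin n)) ⟩
  length (filter ((_∈? (s ∷ p)) ∘ Fin.suc) (allFin n))  ≡⟨ count-tabulate (_∈? (s ∷ p)) Fin.suc id ⟨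
  length (filter (_∈? (s ∷ p)) (List.tabulate Fin.suc)) ∎
  where open ≡-Reasoning

x∈p─q⇒x∉q : ∀ {n} (p q : Subset n) {x} → x ∈ p ─ q → x ∉ q
x∈p─q⇒x∉q (inside ∷ p)  (inside ∷ q) () Vec.here
x∈p─q⇒x∉q (outside ∷ p) (inside ∷ q) () Vec.here
x∈p─q⇒x∉q (s ∷ p) (t ∷ q) (Vec.there x∈p─q) (Vec.there x∈q) = x∈p─q⇒x∉q p q x∈p─q x∈q

size-split : ∀ {n} (p q : Subset n) → ∣ p ∣ ≡ ∣ p ∩ q ∣ + ∣ p ─ q ∣
size-split []            []            = refl
size-split (inside ∷ p)  (inside ∷ q)  = cong suc (size-split p q)
size-split (inside ∷ p)  (outside ∷ q) = trans (cong suc (size-split p q)) (sym (+-suc _ _))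
size-split (outside ∷ p) (inside ∷ q)  = size-split p q
size-split (outside ∷ p) (outside ∷ q) = size-split p q

size-partition : ∀ {n} {p q r : Subset n} → q ⊆ p → r ⊆ p → (∀ {x} → x ∈ p → x ∈ q ⊎ x ∈ r) →
  (∀ {x} → x ∈ q → x ∉ r) → ∣ p ∣ ≡ ∣ q ∣ + ∣ r ∣
size-partition {p = p} {q} {r} q⊆p r⊆p cover disjoint =
  trans (size-split p q) (cong₂ _+_ (cong ∣_∣ p∩q≡q) (cong ∣_∣ p─q≡r))
  where
  p∩q≡q : p ∩ q ≡ q
  p∩q≡q = ⊆-antisym (proj₂ ∘ x∈p∩q⁻ p q) (λ x∈q → x∈p∩q⁺ (q⊆p x∈q , x∈q))
  p─q≡r : p ─ q ≡ r
  p─q≡r = ⊆-antisym from (λ x∈r → x∈p∧x∉q⇒x∈p─q (r⊆p x∈r) (λ x∈q → disjoint x∈q x∈r))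
    where
    from : p ─ q ⊆ r
    from x∈p─q with cover (p─q⊆p p q x∈p─q)
    ... | inj₁ x∈q = ⊥-elim (x∈p─q⇒x∉q p q x∈p─q x∈q)
    ... | inj₂ x∈r = x∈r

size-minus : ∀ {n} {p : Subset n} {x} → x ∈ p → ∣ p ∣ ≡ suc ∣ p - x ∣
size-minus {p = p} {x} x∈p =
  trans (size-partition ⁅x⁆⊆p (p─q⊆p p ⁅ x ⁆) cover (λ y∈⁅x⁆ y∈p-x → x∈p─q⇒x∉q p ⁅ x ⁆ y∈p-x y∈⁅x⁆))
        (cong (_+ ∣ p - x ∣) (∣⁅x⁆∣≡1 x))
  where
  ⁅x⁆⊆p : ⁅ x ⁆ ⊆ p
  ⁅x⁆⊆p y∈⁅x⁆ = subst (_∈ p) (sym (x∈⁅y⁆⇒x≡y x y∈⁅x⁆)) x∈p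
  cover : ∀ {y} → y ∈ p → y ∈ ⁅ x ⁆ ⊎ y ∈ p - x
  cover {y} y∈p with y ≟ᶠ x
  ... | yes refl = inj₁ (x∈⁅x⁆ x)
  ... | no y≢x   = inj₂ (x∈p∧x≢y⇒x∈p-y y∈p y≢x)

⊆-size-eq : ∀ {n} {p q : Subset n} → p ⊆ q → ∣ p ∣ ≡ ∣ q ∣ → p ≡ q
⊆-size-eq {p = p} {q} p⊆q ∣p∣≡∣q∣ = ⊆-antisym p⊆q q⊆p
  where
  q⊆p : q ⊆ p
  q⊆p {x} x∈q with x ∈? p
  ... | yes x∈p = x∈p
  ... | no  x∉p = ⊥-elim (<-irrefl ∣p∣≡∣q∣ (p⊂q⇒∣p∣<∣q∣ (p⊆q , x , x∈q , x∉p)))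

minus-⊆ : ∀ {n} {p q : Subset n} {x} → x ∈ q → p - x ⊆ q - x → p ⊆ q
minus-⊆ {p = p} {q} {x} x∈q p-x⊆q-x {y} y∈p with y ≟ᶠ x
... | yes refl = x∈q
... | no  y≢x  = p─q⊆p q ⁅ x ⁆ (p-x⊆q-x (x∈p∧x≢y⇒x∈p-y y∈p y≢x))

minus-injective : ∀ {n} {p q : Subset n} {x} → x ∈ p → x ∈ q → p - x ≡ q - x → p ≡ q
minus-injective x∈p x∈q eq = ⊆-antisym (minus-⊆ x∈q (⊆-reflexive eq)) (minus-⊆ x∈p (⊆-reflexive (sym eq)))

minus-mono : ∀ {n} {p q : Subset n} {x} → p ⊆ q → p - x ⊆ q - x
minus-mono {p = p} {q} {x} p⊆q y∈p-x =
  x∈p∧x∉q⇒x∈p─q (p⊆q (p─q⊆p p ⁅ x ⁆ y∈p-x)) (x∈p─q⇒x∉q p ⁅ x ⁆ y∈p-x)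

module _ {a} {A : Set a} where

  sum-cong : ∀ (f g : A → ℕ) xs → (∀ {x} → x ∈ₗ xs → f x ≡ g x) → sum (map f xs) ≡ sum (map g xs)
  sum-cong f g xs f≡g = cong sum (map-cong-local (All.tabulate f≡g))

  sum-mono : ∀ (f g : A → ℕ) xs → (∀ {x} → x ∈ₗ xs → f x ≤ g x) → sum (map f xs) ≤ sum (map g xs)
  sum-mono f g []       f≤g = z≤n
  sum-mono f g (x ∷ xs) f≤g = +-mono-≤ (f≤g (here refl)) (sum-mono f g xs (f≤g ∘ there))

  sum-zero : ∀ (xs : List A) → sum (map (λ _ → 0) xs) ≡ 0
  sum-zero []       = refl
  sum-zero (x ∷ xs) = sum-zero xs

  sum-+ : ∀ (f g : A → ℕ) xs → sum (map (λ x → f x + g x) xs) ≡ sum (map f xs) + sum (map g xs)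
  sum-+ f g []       = refl
  sum-+ f g (x ∷ xs) = trans (cong (f x + g x +_) (sum-+ f g xs)) (+-interchange (f x) (g x) _ _)

  sum-*ˡ : ∀ K (f : A → ℕ) xs → sum (map (λ x → K * f x) xs) ≡ K * sum (map f xs)
  sum-*ˡ K f []       = sym (*-zeroʳ K)
  sum-*ˡ K f (x ∷ xs) = trans (cong (K * f x +_) (sum-*ˡ K f xs)) (sym (*-distribˡ-+ K (f x) _))

  sum-indicator : ∀ {p} {P : A → Set p} (P? : ∀ x → Dec (P x)) K xs →
    sum (map (λ x → if does (P? x) then K else 0) xs) ≡ length (filter P? xs) * K
  sum-indicator P? K []       = refl
  sum-indicator P? K (x ∷ xs) with P? x
  ... | yes _ = cong (K +_) (sum-indicator P? K xs)
  ... | no _  = sum-indicator P? K xs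

double-count : ∀ {a b r} {A : Set a} {B : Set b} {R : A → B → Set r} (R? : ∀ x P → Dec (R x P))
  (g : B → ℕ) (xs : List A) (𝒫 : List B) →
  sum (map (λ P → length (filter (λ x → R? x P) xs) * g P) 𝒫) ≡ sum (map (λ x → sum (map g (filter (R? x) 𝒫))) xs)
double-count R? g xs []      = sym (sum-zero xs)
double-count R? g xs (P ∷ 𝒫) = sym (begin
  sum (map (λ x → sum (map g (filter (R? x) (P ∷ 𝒫)))) xs)
    ≡⟨ sum-cong _ _ xs (λ {x} _ → head-term x) ⟩
  sum (map (λ x → (if does (R? x P) then g P else 0) + sum (map g (filter (R? x) 𝒫))) xs)
    ≡⟨ sum-+ _ _ xs ⟩
  sum (map (λ x → if does (R? x P) then g P else 0) xs) + sum (map (λ x → sum (map g (filter (R? x) 𝒫))) xs)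
    ≡⟨ cong₂ _+_ (sum-indicator (λ x → R? x P) (g P) xs) (sym (double-count R? g xs 𝒫)) ⟩
  length (filter (λ x → R? x P) xs) * g P + sum (map (λ P → length (filter (λ x → R? x P) xs) * g P) 𝒫) ∎)
  where
  open ≡-Reasoning
  head-term : ∀ x → sum (map g (filter (R? x) (P ∷ 𝒫))) ≡ (if does (R? x P) then g P else 0) + sum (map g (filter (R? x) 𝒫))
  head-term x with R? x P
  ... | yes _ = refl
  ... | no _  = refl

unique-map : ∀ {a b} {A : Set a} {B : Set b} (f : A → B) {xs : List A} → Unique xs →
  (∀ {x y} → x ∈ₗ xs → y ∈ₗ xs → f x ≡ f y → x ≡ y) → Unique (map f xs)
unique-map f []                   inj = []
unique-map f {x ∷ xs} (x∉xs ∷ u) inj = fresh xs x∉xs there ∷ unique-map f u (λ m m′ → inj (there m) (there m′))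
  where
  fresh : ∀ ys → All (λ y → ¬ x ≡ y) ys → (∀ {y} → y ∈ₗ ys → y ∈ₗ x ∷ xs) → All (λ y → ¬ f x ≡ y) (map f ys)
  fresh []       []         _   = []
  fresh (y ∷ ys) (x≢y ∷ ne) sub = (x≢y ∘ inj (here refl) (sub (here refl))) ∷ fresh ys ne (sub ∘ there)

module _ {a} {A : Set a} (f : A → ℕ) where

  least-member : ∀ x xs → ∃ λ y → y ∈ₗ x ∷ xs × (∀ {z} → z ∈ₗ x ∷ xs → f y ≤ f z)
  least-member x xs = argmin f x xs , member (argmin-sel f x xs) , least
    where
    member : argmin f x xs ≡ x ⊎ argmin f x xs ∈ₗ xs → argmin f x xs ∈ₗ x ∷ xs
    member (inj₁ ≡x) = here ≡x
    member (inj₂ ∈xs) = there ∈xs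
    least : ∀ {z} → z ∈ₗ x ∷ xs → f (argmin f x xs) ≤ f z
    least (here refl) = f[argmin]≤f[⊤] {f = f} x xs
    least (there z∈xs) = All.lookup (f[argmin]≤f[xs] {f = f} x xs) z∈xs

  length*least≤sum : ∀ {w} xs → (∀ {z} → z ∈ₗ xs → w ≤ f z) → length xs * w ≤ sum (map f xs)
  length*least≤sum []       _    = z≤n
  length*least≤sum (x ∷ xs) w≤f = +-mono-≤ (w≤f (here refl)) (length*least≤sum xs (w≤f ∘ there))

-- The number of maximal chains of the Boolean lattice of a c-element set passing through S.
chains : ∀ {n} → ℕ → Subset n → ℕ
chains c S = ∣ S ∣ ! * (c ∸ ∣ S ∣) !

chains-pos : ∀ {n} c (S : Subset n) → 0 < chains c S
chains-pos c S = *-mono-≤ (1≤n! ∣ S ∣) (1≤n! (c ∸ ∣ S ∣))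

-- A chain through a non-empty S passes through S - x for one of the |S| choices of x.
chains-step : ∀ s c → ¬ s ≡ 0 → s ! * (suc c ∸ s) ! ≡ s * ((s ∸ 1) ! * (c ∸ (s ∸ 1)) !)
chains-step zero    c s≢0 = ⊥-elim (s≢0 refl)
chains-step (suc s) c _   = *-assoc (suc s) (s !) ((c ∸ s) !)

size-zero : ∀ {n} {S : Subset n} {x} → ∣ S ∣ ≡ 0 → x ∉ S
size-zero {S = S} ∣S∣≡0 x∈S = 1+n≢0 (trans (sym (size-minus {p = S} x∈S)) ∣S∣≡0)

-- A weighted LYM inequality for families of tagged sets (S , τ).  The classical LYM inequality is the case of a
-- single tag with weight 1; the product version needed below tags a set S with a set T.
module WeightedLYM {Tag : Set} (g : Tag → ℕ) (M : ℕ) where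

  Antichain : ∀ {n} → List (Subset n × Tag) → Set
  Antichain 𝒫 = ∀ {P Q} → P ∈ₗ 𝒫 → Q ∈ₗ 𝒫 → proj₁ P ⊆ proj₁ Q → proj₁ P ≡ proj₁ Q

  FibreBound : ∀ {n} → List (Subset n × Tag) → Set
  FibreBound {n} 𝒫 = ∀ (S : Subset n) (τs : List Tag) → Unique τs → (∀ {τ} → τ ∈ₗ τs → (S , τ) ∈ₗ 𝒫) →
    sum (map g τs) ≤ M

  weight : ∀ {n} → ℕ → Subset n × Tag → ℕ
  weight c (S , τ) = chains c S * g τ

  shrink : ∀ {n} → Fin n → List (Subset n × Tag) → List (Subset n × Tag)
  shrink x 𝒫 = map (λ P → proj₁ P - x , proj₂ P) (filter (λ P → x ∈? proj₁ P) 𝒫)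

  module _ {n} (x : Fin n) (𝒫 : List (Subset n × Tag)) where

    shrink⁻ : ∀ {P′} → P′ ∈ₗ shrink x 𝒫 → ∃ λ P → P ∈ₗ 𝒫 × x ∈ proj₁ P × P′ ≡ (proj₁ P - x , proj₂ P)
    shrink⁻ m with ∈-map⁻ _ m
    ... | P , m′ , eq = P , proj₁ (∈-filter⁻ (λ P → x ∈? proj₁ P) {xs = 𝒫} m′) ,
                            proj₂ (∈-filter⁻ (λ P → x ∈? proj₁ P) {xs = 𝒫} m′) , eq

    shrink-unique : Unique 𝒫 → Unique (shrink x 𝒫)
    shrink-unique u = unique-map _ (filter⁺ (λ P → x ∈? proj₁ P) u) inj
      where
      inj : ∀ {P Q} → P ∈ₗ filter (λ P → x ∈? proj₁ P) 𝒫 → Q ∈ₗ filter (λ P → x ∈? proj₁ P) 𝒫 →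
            (proj₁ P - x , proj₂ P) ≡ (proj₁ Q - x , proj₂ Q) → P ≡ Q
      inj mP mQ eq = cong₂ _,_
        (minus-injective (proj₂ (∈-filter⁻ (λ P → x ∈? proj₁ P) {xs = 𝒫} mP))
                         (proj₂ (∈-filter⁻ (λ P → x ∈? proj₁ P) {xs = 𝒫} mQ)) (cong proj₁ eq))
        (cong proj₂ eq)

    shrink-⊆ : ∀ {X} → All ((_⊆ X) ∘ proj₁) 𝒫 → All ((_⊆ X - x) ∘ proj₁) (shrink x 𝒫)
    shrink-⊆ 𝒫⊆X = All.tabulate λ m → case shrink⁻ m of λ where
      (P , mP , _ , refl) → minus-mono (All.lookup 𝒫⊆X mP)

    shrink-antichain : Antichain 𝒫 → Antichain (shrink x 𝒫)
    shrink-antichain ac m m′ ⊆ with shrink⁻ m | shrink⁻ m′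
    ... | P , mP , x∈P , refl | Q , mQ , x∈Q , refl = cong (_- x) (ac mP mQ (minus-⊆ x∈Q ⊆))

    shrink-fibre : FibreBound 𝒫 → FibreBound (shrink x 𝒫)
    shrink-fibre fb S []        _ _   = z≤n
    shrink-fibre fb S (τ₀ ∷ τs) u mem with shrink⁻ (mem (here refl))
    ... | (S₀ , _) , _ , x∈S₀ , refl = fb S₀ (τ₀ ∷ τs) u lift
      where
      lift : ∀ {τ} → τ ∈ₗ τ₀ ∷ τs → (S₀ , τ) ∈ₗ 𝒫
      lift m with shrink⁻ (mem m)
      ... | (S₁ , _) , mP , x∈S₁ , eq = subst (_∈ₗ 𝒫) (cong₂ _,_ (minus-injective x∈S₁ x∈S₀ (sym (cong proj₁ eq))) (sym (cong proj₂ eq))) mP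

  -- If some set of the family is empty, all sets are equal (to it), so the family is a single
  -- fibre and the bound is c! times the fibre bound.
  lym-bottom : ∀ {n} c (𝒫 : List (Subset n × Tag)) → Unique 𝒫 → Antichain 𝒫 → FibreBound 𝒫 →
    ∀ {P₀} → P₀ ∈ₗ 𝒫 → ∣ proj₁ P₀ ∣ ≡ 0 → sum (map (weight c) 𝒫) ≤ c ! * M
  lym-bottom c 𝒫 u ac fb {S₀ , _} m₀ ∣S₀∣≡0 = begin
    sum (map (weight c) 𝒫)                  ≡⟨ sum-cong _ _ 𝒫 weight≡ ⟩
    sum (map (λ P → c ! * g (proj₂ P)) 𝒫)    ≡⟨ sum-*ˡ (c !) (g ∘ proj₂) 𝒫 ⟩
    c ! * sum (map (g ∘ proj₂) 𝒫)           ≡⟨ cong (λ l → c ! * sum l) (map-∘ 𝒫) ⟩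
    c ! * sum (map g (map proj₂ 𝒫))         ≤⟨ *-monoʳ-≤ (c !) (fb S₀ (map proj₂ 𝒫) tags-unique tags-in-fibre) ⟩
    c ! * M                                 ∎
    where
    open ≤-Reasoning
    all-S₀ : ∀ {P} → P ∈ₗ 𝒫 → proj₁ P ≡ S₀
    all-S₀ m = sym (ac m₀ m (λ x∈S₀ → ⊥-elim (size-zero ∣S₀∣≡0 x∈S₀)))
    weight≡ : ∀ {P} → P ∈ₗ 𝒫 → weight c P ≡ c ! * g (proj₂ P)
    weight≡ {P} m = cong (_* g (proj₂ P))
      (trans (cong (λ s → s ! * (c ∸ s) !) (trans (cong ∣_∣ (all-S₀ m)) ∣S₀∣≡0)) (+-identityʳ (c !)))
    tags-unique : Unique (map proj₂ 𝒫)
    tags-unique = unique-map proj₂ u (λ mP mQ eq → cong₂ _,_ (trans (all-S₀ mP) (sym (all-S₀ mQ))) eq)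
    tags-in-fibre : ∀ {τ} → τ ∈ₗ map proj₂ 𝒫 → (S₀ , τ) ∈ₗ 𝒫
    tags-in-fibre m with ∈-map⁻ proj₂ m
    ... | P , mP , refl = subst (_∈ₗ 𝒫) (cong (_, proj₂ P) (all-S₀ mP)) mP

  lym : ∀ {n} c (X : Subset n) → ∣ X ∣ ≡ c → (𝒫 : List (Subset n × Tag)) → Unique 𝒫 →
        All ((_⊆ X) ∘ proj₁) 𝒫 → Antichain 𝒫 → FibreBound 𝒫 → sum (map (weight c) 𝒫) ≤ c ! * M

  -- If no set is empty, each chain through S passes through S - x for some x ∈ S; double counting
  -- over x reduces to the shrunk families inside X - x.
  lym-descent : ∀ {n} c (X : Subset n) → ∣ X ∣ ≡ c → (𝒫 : List (Subset n × Tag)) → Unique 𝒫 →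
        All ((_⊆ X) ∘ proj₁) 𝒫 → Antichain 𝒫 → FibreBound 𝒫 → (∀ {P} → P ∈ₗ 𝒫 → ¬ ∣ proj₁ P ∣ ≡ 0) →
        sum (map (weight c) 𝒫) ≤ c ! * M

  lym c X ∣X∣ 𝒫 u ⊆X ac fb with Any.any? (λ P → ∣ proj₁ P ∣ ≟ 0) 𝒫
  ... | yes has-empty = let (_ , m₀ , empty) = find has-empty in lym-bottom c 𝒫 u ac fb m₀ empty
  ... | no  no-empty  = lym-descent c X ∣X∣ 𝒫 u ⊆X ac fb (λ m empty → no-empty (lose m empty))

  lym-descent zero X ∣X∣ []      _ _           _ _ _        = z≤n
  lym-descent zero X ∣X∣ (P ∷ 𝒫) _ (P⊆X ∷ _) _ _ nonempty =
    ⊥-elim (nonempty (here refl) (n≤0⇒n≡0 (≤-trans (p⊆q⇒∣p∣≤∣q∣ P⊆X) (≤-reflexive ∣X∣))))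
  lym-descent {n} (suc c) X ∣X∣ 𝒫 u ⊆X ac fb nonempty = begin
    sum (map (weight (suc c)) 𝒫)
      ≡⟨ sum-cong _ _ 𝒫 (λ m → split-weight (nonempty m)) ⟩
    sum (map (λ P → length (filter (_∈? proj₁ P) (allFin n)) * lower P) 𝒫)
      ≡⟨ double-count (λ x P → x ∈? proj₁ P) lower (allFin n) 𝒫 ⟩
    sum (map (λ x → sum (map lower (filter (λ P → x ∈? proj₁ P) 𝒫))) (allFin n))
      ≤⟨ sum-mono _ _ (allFin n) (λ {x} _ → through x) ⟩
    sum (map (λ x → if does (x ∈? X) then c ! * M else 0) (allFin n))
      ≡⟨ sum-indicator (_∈? X) (c ! * M) (allFin n) ⟩
    length (filter (_∈? X) (allFin n)) * (c ! * M)
      ≡⟨ cong (_* (c ! * M)) (trans (sym (size≡count X)) ∣X∣) ⟩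
    suc c * (c ! * M)
      ≡⟨ *-assoc (suc c) (c !) M ⟨
    suc c ! * M ∎
    where
    open ≤-Reasoning
    lower : Subset n × Tag → ℕ
    lower P = (∣ proj₁ P ∣ ∸ 1) ! * (c ∸ (∣ proj₁ P ∣ ∸ 1)) ! * g (proj₂ P)

    split-weight : ∀ {P} → ¬ ∣ proj₁ P ∣ ≡ 0 → weight (suc c) P ≡ length (filter (_∈? proj₁ P) (allFin n)) * lower P
    split-weight {S , τ} S≢∅ = begin-equality
      ∣ S ∣ ! * (suc c ∸ ∣ S ∣) ! * g τ                           ≡⟨ cong (_* g τ) (chains-step ∣ S ∣ c S≢∅) ⟩
      ∣ S ∣ * ((∣ S ∣ ∸ 1) ! * (c ∸ (∣ S ∣ ∸ 1)) !) * g τ           ≡⟨ *-assoc ∣ S ∣ _ (g τ) ⟩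
      ∣ S ∣ * lower (S , τ)                                       ≡⟨ cong (_* lower (S , τ)) (size≡count S) ⟩
      length (filter (_∈? S) (allFin n)) * lower (S , τ)          ∎

    through : ∀ x → sum (map lower (filter (λ P → x ∈? proj₁ P) 𝒫)) ≤ (if does (x ∈? X) then c ! * M else 0)
    through x with x ∈? X
    ... | no x∉X = ≤-reflexive (cong (sum ∘ map lower)
                     (filter-none (λ P → x ∈? proj₁ P) (All.map (λ P⊆X x∈P → x∉X (P⊆X x∈P)) ⊆X)))
    ... | yes x∈X = begin
      sum (map lower (filter (λ P → x ∈? proj₁ P) 𝒫))
        ≡⟨ sum-cong _ _ _ lower≡weight ⟩
      sum (map (weight c ∘ (λ P → proj₁ P - x , proj₂ P)) (filter (λ P → x ∈? proj₁ P) 𝒫))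
        ≡⟨ cong sum (map-∘ (filter (λ P → x ∈? proj₁ P) 𝒫)) ⟩
      sum (map (weight c) (shrink x 𝒫))
        ≤⟨ lym c (X - x) (suc-injective (trans (sym (size-minus x∈X)) ∣X∣)) (shrink x 𝒫) (shrink-unique x 𝒫 u)
               (shrink-⊆ x 𝒫 ⊆X) (shrink-antichain x 𝒫 ac) (shrink-fibre x 𝒫 fb) ⟩
      c ! * M ∎
      where
      lower≡weight : ∀ {P} → P ∈ₗ filter (λ P → x ∈? proj₁ P) 𝒫 → lower P ≡ weight c (proj₁ P - x , proj₂ P)
      lower≡weight {P} m = cong (λ s → s ! * (c ∸ s) ! * g (proj₂ P))
        (cong (_∸ 1) (size-minus (proj₂ (∈-filter⁻ (λ P → x ∈? proj₁ P) {xs = 𝒫} m))))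

IsAntichain : ∀ {n} → List (Subset n) → Set
IsAntichain 𝒜 = ∀ {A A′} → A ∈ₗ 𝒜 → A′ ∈ₗ 𝒜 → A ⊆ A′ → A ≡ A′

LYM : ∀ {n} c (X : Subset n) → ∣ X ∣ ≡ c → (𝒜 : List (Subset n)) → Unique 𝒜 → All (_⊆ X) 𝒜 →
  IsAntichain 𝒜 → sum (map (chains c) 𝒜) ≤ c !
LYM c X ∣X∣ 𝒜 u ⊆X ac = begin
  sum (map (chains c) 𝒜)                ≡⟨ sum-cong _ _ 𝒜 (λ {A} _ → sym (*-identityʳ (chains c A))) ⟩
  sum (map (weight c ∘ (_, tt)) 𝒜)       ≡⟨ cong sum (map-∘ 𝒜) ⟩
  sum (map (weight c) (map (_, tt) 𝒜))   ≤⟨ lym c X ∣X∣ (map (_, tt) 𝒜) (unique-map (_, tt) u (λ _ _ → cong proj₁))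
                                              (All.map⁺ ⊆X) antichain single-tag ⟩
  c ! * 1                               ≡⟨ *-identityʳ (c !) ⟩
  c !                                   ∎
  where
  open ≤-Reasoning
  open WeightedLYM {⊤} (λ _ → 1) 1
  antichain : Antichain (map (_, tt) 𝒜)
  antichain m m′ ⊆ with ∈-map⁻ (_, tt) m | ∈-map⁻ (_, tt) m′
  ... | _ , mA , refl | _ , mA′ , refl = ac mA mA′ ⊆
  single-tag : FibreBound (map (_, tt) 𝒜)
  single-tag S []              _                 _ = z≤n
  single-tag S (tt ∷ [])       _                 _ = ≤-refl
  single-tag S (tt ∷ tt ∷ _)   ((tt≢tt ∷ _) ∷ _) _ = ⊥-elim (tt≢tt refl)

product-LYM : ∀ {n} c d (X Y : Subset n) → ∣ X ∣ ≡ c → ∣ Y ∣ ≡ d → (𝒫 : List (Subset n × Subset n)) →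
  Unique 𝒫 → All (λ P → proj₁ P ⊆ X × proj₂ P ⊆ Y) 𝒫 →
  (∀ {P Q} → P ∈ₗ 𝒫 → Q ∈ₗ 𝒫 → proj₁ P ⊆ proj₁ Q → proj₁ P ≡ proj₁ Q) →
  (∀ {P Q} → P ∈ₗ 𝒫 → Q ∈ₗ 𝒫 → proj₁ P ≡ proj₁ Q → proj₂ P ⊆ proj₂ Q → proj₂ P ≡ proj₂ Q) →
  sum (map (λ P → chains c (proj₁ P) * chains d (proj₂ P)) 𝒫) ≤ c ! * d !
product-LYM c d X Y ∣X∣ ∣Y∣ 𝒫 u ⊆XY ac₁ ac₂ =
  lym c X ∣X∣ 𝒫 u (All.map proj₁ ⊆XY) ac₁ fibre-LYM
  where
  open WeightedLYM (chains d) (d !)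
  fibre-LYM : FibreBound 𝒫
  fibre-LYM S Ts u-Ts mem = LYM d Y ∣Y∣ Ts u-Ts (All.tabulate (proj₂ ∘ All.lookup ⊆XY ∘ mem))
    (λ m m′ → ac₂ (mem m) (mem m′) refl)

module Estimates where

  open ≤-Reasoning

  sq : ℕ → ℕ
  sq x = x * x

  sq-mono : ∀ {x y} → x ≤ y → sq x ≤ sq y
  sq-mono x≤y = *-mono-≤ x≤y x≤y

  ^-distribʳ-* : ∀ a b n → (a * b) ^ n ≡ a ^ n * b ^ n
  ^-distribʳ-* a b zero    = refl
  ^-distribʳ-* a b (suc n) = trans (cong (a * b *_) (^-distribʳ-* a b n)) (lemma a b (a ^ n) (b ^ n))
    where
    lemma : ∀ a b x y → a * b * (x * y) ≡ a * x * (b * y)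
    lemma = solve-∀

  ^-pos : ∀ a n → 0 < a → 0 < a ^ n
  ^-pos a n 0<a = m^n>0 a ⦃ >-nonZero 0<a ⦄ n

  n^n-pos : ∀ n → 0 < n ^ n
  n^n-pos zero    = s≤s z≤n
  n^n-pos (suc n) = m^n>0 (suc n) (suc n)

  *-cancelˡ-≤-pos : ∀ x {m n} → 0 < x → x * m ≤ x * n → m ≤ n
  *-cancelˡ-≤-pos (suc x) _ = *-cancelˡ-≤ (suc x)

  2uw≤u²+w² : ∀ u w → 2 * u * w ≤ u * u + w * w
  2uw≤u²+w² u w with ≤-total u w
  ... | inj₁ u≤w with m≤n⇒∃[o]m+o≡n u≤w
  ...   | t , refl = subst (2 * u * (u + t) ≤_) (lemma u t) (m≤m+n _ (t * t))
    where
    lemma : ∀ u t → 2 * u * (u + t) + t * t ≡ u * u + (u + t) * (u + t)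
    lemma = solve-∀
  2uw≤u²+w² u w | inj₂ w≤u with m≤n⇒∃[o]m+o≡n w≤u
  ...   | t , refl = subst (2 * (w + t) * w ≤_) (lemma w t) (m≤m+n _ (t * t))
    where
    lemma : ∀ w t → 2 * (w + t) * w + t * t ≡ (w + t) * (w + t) + w * w
    lemma = solve-∀

  am-gm-one-vs-many : ∀ n u w → suc n * u * w ^ n ≤ u ^ suc n + n * w ^ suc n
  am-gm-one-vs-many zero u w = ≤-reflexive (lemma u)
    where
    lemma : ∀ u → 1 * u * 1 ≡ u * 1 + 0 * (u * 1)
    lemma = solve-∀
  am-gm-one-vs-many (suc n) u w = +-cancelʳ-≤ X _ _ (subst₂ _≤_ (lhs n u w P) (rhs n u w P U)
      (+-mono-≤ (*-monoʳ-≤ u (am-gm-one-vs-many n u w)) (*-monoʳ-≤ (suc n * P) (2uw≤u²+w² u w))))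
    where
    P U X : ℕ
    P = w ^ n
    U = u ^ suc n
    X = suc n * u * u * P + n * u * (w * P)
    lhs : ∀ n u w P → u * (suc n * u * P) + suc n * P * (2 * u * w) ≡ suc (suc n) * u * (w * P) + (suc n * u * u * P + n * u * (w * P))
    lhs = solve-∀
    rhs : ∀ n u w P U → u * (U + n * (w * P)) + suc n * P * (u * u + w * w) ≡ (u * U + suc n * (w * (w * P))) + (suc n * u * u * P + n * u * (w * P))
    rhs = solve-∀

  -- The inductive step of AM-GM: (n+1)ⁿ⁺¹ · y · sⁿ ≤ nⁿ · (y + s)ⁿ⁺¹, i.e. adding a value y to
  -- n values of sum s (the case u = n(y+s), w = (n+1)s of the previous lemma).
  am-gm-step : ∀ n y s → suc n ^ suc n * y * s ^ n ≤ n ^ n * (y + s) ^ suc n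
  am-gm-step zero    y s = subst (1 * 1 * y * 1 ≤_) (lemma y s) (m≤m+n _ s)
    where
    lemma : ∀ y s → 1 * 1 * y * 1 + s ≡ 1 * ((y + s) * 1)
    lemma = solve-∀
  am-gm-step (suc m) y s = *-cancelˡ-≤-pos N (s≤s z≤n) (+-cancelʳ-≤ Z _ _ (subst₂ _≤_ lhs rhs
      (am-gm-one-vs-many N (N * (y + s)) (suc N * s))))
    where
    N Z : ℕ
    N = suc m
    Z = N * (suc N * s * (suc N ^ N * s ^ N))
    w^N : (suc N * s) ^ N ≡ suc N ^ N * s ^ N
    w^N = ^-distribʳ-* (suc N) s N
    lhs : suc N * (N * (y + s)) * (suc N * s) ^ N ≡ N * (suc N ^ suc N * y * s ^ N) + Z
    lhs = trans (cong (suc N * (N * (y + s)) *_) w^N) (lemma N (suc N ^ N) y (s ^ N) s)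
      where
      lemma : ∀ N Mn y Sn s → suc N * (N * (y + s)) * (Mn * Sn) ≡ N * (suc N * Mn * y * Sn) + N * (suc N * s * (Mn * Sn))
      lemma = solve-∀
    rhs : (N * (y + s)) ^ suc N + N * (suc N * s) ^ suc N ≡ N * (N ^ N * (y + s) ^ suc N) + Z
    rhs = cong₂ _+_ (trans (^-distribʳ-* N (y + s) (suc N)) (*-assoc N (N ^ N) _))
                    (cong (λ v → N * (suc N * s * v)) w^N)

  am-gm : ∀ xs → length xs ^ length xs * product xs ≤ sum xs ^ length xs
  am-gm []       = s≤s z≤n
  am-gm (y ∷ ys) = *-cancelˡ-≤-pos (ℓ ^ ℓ) (n^n-pos ℓ) (begin
    ℓ ^ ℓ * (suc ℓ ^ suc ℓ * (y * Π))  ≡⟨ lemma (ℓ ^ ℓ) (suc ℓ ^ suc ℓ) y Π ⟩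
    suc ℓ ^ suc ℓ * y * (ℓ ^ ℓ * Π)    ≤⟨ *-monoʳ-≤ (suc ℓ ^ suc ℓ * y) (am-gm ys) ⟩
    suc ℓ ^ suc ℓ * y * s ^ ℓ          ≤⟨ am-gm-step ℓ y s ⟩
    ℓ ^ ℓ * (y + s) ^ suc ℓ            ∎)
    where
    ℓ s Π : ℕ
    ℓ = length ys
    s = sum ys
    Π = product ys
    lemma : ∀ a b y p → a * (b * (y * p)) ≡ b * y * (a * p)
    lemma = solve-∀

  sum-replicate : ∀ h x → sum (replicate h x) ≡ h * x
  sum-replicate zero    x = refl
  sum-replicate (suc h) x = cong (x +_) (sum-replicate h x)

  product-replicate : ∀ h x → product (replicate h x) ≡ x ^ h
  product-replicate zero    x = refl
  product-replicate (suc h) x = cong (x *_) (product-replicate h x)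

  -- Weighted AM-GM for two values: cʰ dᵏ (h+k)^(h+k) ≤ (c+d)^(h+k) hʰ kᵏ,
  -- i.e. (c/h)ʰ (d/k)ᵏ ≤ ((c+d)/(h+k))^(h+k); AM-GM applied to h copies of ck and k copies of dh.
  weighted-am-gm : ∀ h k c d → 0 < h → 0 < k →
    c ^ h * d ^ k * (h + k) ^ (h + k) ≤ (c + d) ^ (h + k) * h ^ h * k ^ k
  weighted-am-gm h k c d 0<h 0<k = *-cancelˡ-≤-pos (k ^ h * h ^ k) (*-mono-≤ (^-pos k h 0<k) (^-pos h k 0<h)) (begin
    k ^ h * h ^ k * (c ^ h * d ^ k * (h + k) ^ (h + k))
      ≡⟨ rearrange₁ (k ^ h) (h ^ k) (c ^ h) (d ^ k) ((h + k) ^ (h + k)) ⟩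
    (h + k) ^ (h + k) * ((c ^ h * k ^ h) * (d ^ k * h ^ k))
      ≡⟨ cong ((h + k) ^ (h + k) *_) (cong₂ _*_ (^-distribʳ-* c k h) (^-distribʳ-* d h k)) ⟨
    (h + k) ^ (h + k) * ((c * k) ^ h * (d * h) ^ k)
      ≡⟨ cong₂ (λ l p → l ^ l * p) length-xs product-xs ⟨
    length xs ^ length xs * product xs
      ≤⟨ am-gm xs ⟩
    sum xs ^ length xs
      ≡⟨ cong₂ _^_ sum-xs length-xs ⟩
    (h * k * (c + d)) ^ (h + k)
      ≡⟨ trans (^-distribʳ-* (h * k) (c + d) (h + k)) (cong (_* (c + d) ^ (h + k)) (^-distribʳ-* h k (h + k))) ⟩
    h ^ (h + k) * k ^ (h + k) * (c + d) ^ (h + k)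
      ≡⟨ cong₂ (λ p q → p * q * (c + d) ^ (h + k)) (^-distribˡ-+-* h h k) (^-distribˡ-+-* k h k) ⟩
    h ^ h * h ^ k * (k ^ h * k ^ k) * (c + d) ^ (h + k)
      ≡⟨ rearrange₂ (h ^ h) (h ^ k) (k ^ h) (k ^ k) ((c + d) ^ (h + k)) ⟩
    k ^ h * h ^ k * ((c + d) ^ (h + k) * h ^ h * k ^ k) ∎)
    where
    xs : List ℕ
    xs = replicate h (c * k) ++ replicate k (d * h)
    length-xs : length xs ≡ h + k
    length-xs = trans (length-++ (replicate h (c * k))) (cong₂ _+_ (length-replicate h) (length-replicate k))
    product-xs : product xs ≡ (c * k) ^ h * (d * h) ^ k
    product-xs = trans (product-++ (replicate h (c * k)) _) (cong₂ _*_ (product-replicate h _) (product-replicate k _))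
    sum-xs : sum xs ≡ h * k * (c + d)
    sum-xs = trans (sum-++ (replicate h (c * k)) _) (trans (cong₂ _+_ (sum-replicate h _) (sum-replicate k _)) (lemma h k c d))
      where
      lemma : ∀ h k c d → h * (c * k) + k * (d * h) ≡ h * k * (c + d)
      lemma = solve-∀
    rearrange₁ : ∀ kh hk ch dk aa → kh * hk * (ch * dk * aa) ≡ aa * ((ch * kh) * (dk * hk))
    rearrange₁ = solve-∀
    rearrange₂ : ∀ hh hk kh kk cd → hh * hk * (kh * kk) * cd ≡ kh * hk * (cd * hh * kk)
    rearrange₂ = solve-∀

  bernoulli : ∀ D j e → j + e ≡ D → suc D ^ j * e ≤ D ^ suc j
  bernoulli D zero e refl = ≤-reflexive (*-comm 1 e)
  bernoulli D (suc j) e j+e≡D = begin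
    suc D ^ suc j * e        ≡⟨ rearrange₁ (suc D ^ j) D e ⟩
    suc D ^ j * (suc D * e)  ≤⟨ *-monoʳ-≤ (suc D ^ j) step ⟩
    suc D ^ j * (D * suc e)  ≡⟨ rearrange₂ (suc D ^ j) D e ⟩
    D * (suc D ^ j * suc e)  ≤⟨ *-monoʳ-≤ D (bernoulli D j (suc e) (trans (+-suc j e) j+e≡D)) ⟩
    D * D ^ suc j            ∎
    where
    rearrange₁ : ∀ p D e → suc D * p * e ≡ p * (suc D * e)
    rearrange₁ = solve-∀
    rearrange₂ : ∀ p D e → p * (D * suc e) ≡ D * (p * suc e)
    rearrange₂ = solve-∀
    step : suc D * e ≤ D * suc e
    step = subst (suc D * e ≤_) (sym (*-suc D e)) (+-monoˡ-≤ (D * e) (subst (e ≤_) j+e≡D (m≤n+m e (suc j))))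

  -- Euler's sequence (1 + 1/a)^a increases: (a+1)^a (a+1)^(a+1) ≤ (a+2)^(a+1) a^a.
  euler-step : ∀ a → suc a ^ a * suc a ^ suc a ≤ suc (suc a) ^ suc a * a ^ a
  euler-step zero    = s≤s z≤n
  euler-step (suc b) = *-cancelˡ-≤-pos A (s≤s z≤n) (subst₂ _≤_ lhs rhs
      (bernoulli D A (A * suc A) (lemma A)))
    where
    A D : ℕ
    A = suc b
    D = A * suc (suc A)
    lemma : ∀ A → A + A * suc A ≡ A * suc (suc A)
    lemma = solve-∀
    lhs : suc D ^ A * (A * suc A) ≡ A * (suc A ^ A * suc A ^ suc A)
    lhs = trans (cong (λ v → v ^ A * (A * suc A)) (square A))
            (trans (cong (_* (A * suc A)) (^-distribʳ-* (suc A) (suc A) A)) (rearrange (suc A ^ A) A))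
      where
      square : ∀ A → suc (A * suc (suc A)) ≡ suc A * suc A
      square = solve-∀
      rearrange : ∀ p A → p * p * (A * suc A) ≡ A * (p * (suc A * p))
      rearrange = solve-∀
    rhs : D ^ suc A ≡ A * (suc (suc A) ^ suc A * A ^ A)
    rhs = trans (^-distribʳ-* A (suc (suc A)) (suc A)) (rearrange A (A ^ A) (suc (suc A) ^ suc A))
      where
      rearrange : ∀ A p q → A * p * q ≡ A * (q * p)
      rearrange = solve-∀

  euler-mono : ∀ k t → suc k ^ k * (k + t) ^ (k + t) ≤ suc (k + t) ^ (k + t) * k ^ k
  euler-mono k zero rewrite +-identityʳ k = ≤-refl
  euler-mono k (suc t) rewrite +-suc k t = *-cancelˡ-≤-pos (suc a ^ a) (m^n>0 (suc a) a) (begin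
    xa * (xk * ya′)  ≡⟨ x∙yz≈y∙xz xa xk ya′ ⟩
    xk * (xa * ya′)  ≤⟨ *-monoʳ-≤ xk (euler-step a) ⟩
    xk * (xa′ * ya)  ≡⟨ x∙yz≈y∙xz xk xa′ ya ⟩
    xa′ * (xk * ya)  ≤⟨ *-monoʳ-≤ xa′ (euler-mono k t) ⟩
    xa′ * (xa * yk)  ≡⟨ x∙yz≈y∙xz xa′ xa yk ⟩
    xa * (xa′ * yk)  ∎)
    where
    a xa xk ya′ xa′ ya yk : ℕ
    a   = k + t
    xa  = suc a ^ a
    xk  = suc k ^ k
    ya′ = suc a ^ suc a
    xa′ = suc (suc a) ^ suc a
    ya  = a ^ a
    yk  = k ^ k

  module BinomialRatio (h : ℕ) where

    numerator : ℕ → ℕ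
    numerator k = (h + k) ! * k ^ k

    denominator : ℕ → ℕ
    denominator k = k ! * (h + k) ^ (h + k)

    denominator-pos : ∀ k → 0 < denominator k
    denominator-pos k = *-mono-≤ (1≤n! k) (n^n-pos (h + k))

    -- One step, from the growth of Euler's sequence (1 + 1/a)^a.
    ratio-step : ∀ k → numerator (suc k) * denominator k ≤ numerator k * denominator (suc k)
    ratio-step k rewrite +-suc h k = subst₂ _≤_
        (lhs (suc a) (suc k) (a !) (k !) (suc k ^ k) (a ^ a)) (rhs (suc a) (suc k) (a !) (k !) (suc a ^ a) (k ^ k))
        (*-monoʳ-≤ (suc a * suc k * a ! * k !) euler)
      where
      a : ℕ
      a = h + k
      euler : suc k ^ k * a ^ a ≤ suc a ^ a * k ^ k
      euler = subst (λ v → suc k ^ k * v ^ v ≤ suc v ^ v * k ^ k) (+-comm k h) (euler-mono k h)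
      lhs : ∀ sa sk F G skk aa → sa * sk * F * G * (skk * aa) ≡ (sa * F) * (sk * skk) * (G * aa)
      lhs = solve-∀
      rhs : ∀ sa sk F G saa kk → sa * sk * F * G * (saa * kk) ≡ F * kk * ((sk * G) * (sa * saa))
      rhs = solve-∀

    ratio-mono : ∀ t → numerator (h + t) * denominator h ≤ numerator h * denominator (h + t)
    ratio-mono zero rewrite +-identityʳ h = ≤-refl
    ratio-mono (suc t) rewrite +-suc h t = *-cancelˡ-≤-pos (denominator k) (denominator-pos k) (begin
      denominator k * (numerator (suc k) * denominator h)      ≡⟨ swap-outer (denominator k) (numerator (suc k)) (denominator h) ⟩
      denominator h * (numerator (suc k) * denominator k)      ≤⟨ *-monoʳ-≤ (denominator h) (ratio-step k) ⟩
      denominator h * (numerator k * denominator (suc k))      ≡⟨ swap-outer (denominator h) (numerator k) (denominator (suc k)) ⟩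
      denominator (suc k) * (numerator k * denominator h)      ≤⟨ *-monoʳ-≤ (denominator (suc k)) (ratio-mono t) ⟩
      denominator (suc k) * (numerator h * denominator k)      ≡⟨ swap-outer (denominator (suc k)) (numerator h) (denominator k) ⟩
      denominator k * (numerator h * denominator (suc k))      ∎)
      where
      k : ℕ
      k = h + t
      swap-outer : ∀ x y z → x * (y * z) ≡ z * (y * x)
      swap-outer = solve-∀

  -- The central binomial coefficient: binom(2h,h)² (2h+1) ≤ 16ʰ, written with factorials.
  central-binomial : ∀ h → sq ((h + h) !) * suc (h + h) ≤ sq (sq (h !)) * 16 ^ h
  central-binomial zero = ≤-refl
  central-binomial (suc h) rewrite +-suc h h = begin
    sq (suc (suc (h + h)) !) * suc (suc (suc (h + h)))  ≡⟨ peel (h + h) ((h + h) !) ⟩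
    P * (sq ((h + h) !) * suc (h + h))                  ≤⟨ *-monoʳ-≤ P (central-binomial h) ⟩
    P * (sq (sq (h !)) * 16 ^ h)                        ≤⟨ *-monoˡ-≤ (sq (sq (h !)) * 16 ^ h) P≤Q ⟩
    Q * (sq (sq (h !)) * 16 ^ h)                        ≡⟨ unpeel h (h !) (16 ^ h) ⟩
    sq (sq (suc h !)) * 16 ^ suc h                      ∎
    where
    P Q : ℕ
    P = suc (suc (h + h)) * suc (suc (h + h)) * suc (h + h) * suc (suc (suc (h + h)))
    Q = 16 * ((suc h * suc h) * (suc h * suc h))
    P≤Q : P ≤ Q
    P≤Q = subst (P ≤_) (gap h) (m≤m+n P _)
      where
      gap : ∀ h → suc (suc (h + h)) * suc (suc (h + h)) * suc (h + h) * suc (suc (suc (h + h)))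
                  + suc (suc (h + h)) * suc (suc (h + h)) ≡ 16 * ((suc h * suc h) * (suc h * suc h))
      gap = solve-∀
    peel : ∀ m f → (suc (suc m) * (suc m * f)) * (suc (suc m) * (suc m * f)) * suc (suc (suc m)) ≡
                   (suc (suc m) * suc (suc m) * suc m * suc (suc (suc m))) * (f * f * suc m)
    peel = solve-∀
    unpeel : ∀ h g p → (16 * ((suc h * suc h) * (suc h * suc h))) * ((g * g) * (g * g) * p) ≡
                       ((suc h * g) * (suc h * g)) * ((suc h * g) * (suc h * g)) * (16 * p)
    unpeel = solve-∀

  double-power : ∀ h → (h + h) ^ (h + h) ≡ 4 ^ h * (h ^ h * h ^ h)
  double-power h = begin-equality
    (h + h) ^ (h + h)         ≡⟨ cong (_^ (h + h)) (double h) ⟩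
    (2 * h) ^ (h + h)         ≡⟨ ^-distribʳ-* 2 h (h + h) ⟩
    2 ^ (h + h) * h ^ (h + h) ≡⟨ cong₂ _*_ (trans (^-distribˡ-+-* 2 h h) (sym (^-distribʳ-* 2 2 h))) (^-distribˡ-+-* h h h) ⟩
    4 ^ h * (h ^ h * h ^ h)   ∎
    where
    double : ∀ h → h + h ≡ 2 * h
    double = solve-∀

  -- The mode of the binomial distribution Bin(h+k, h/(h+k)) has probability at most 1/√h when
  -- h ≤ k:  ((h+k)! hʰ kᵏ)² · h ≤ (h! k! (h+k)^(h+k))².  First the balanced case k = h, which is
  -- the central binomial estimate.
  binomial-mode-balanced : ∀ h → sq ((h + h) ! * h ^ h * h ^ h) * h ≤ sq (h ! * (h ! * (h + h) ^ (h + h)))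
  binomial-mode-balanced h = begin
    sq (F * H * H) * h                                ≡⟨ rearrange₁ F H h ⟩
    (H * H * (H * H)) * (F * F * h)                   ≤⟨ *-monoʳ-≤ (H * H * (H * H))
                                                          (≤-trans (*-monoʳ-≤ (F * F) (m≤n+m h (suc h))) (central-binomial h)) ⟩
    (H * H * (H * H)) * (G * G * (G * G) * 16 ^ h)    ≡⟨ cong (λ v → (H * H * (H * H)) * (G * G * (G * G) * v)) (^-distribʳ-* 4 4 h) ⟩
    (H * H * (H * H)) * (G * G * (G * G) * (V * V))   ≡⟨ rearrange₂ H G V ⟩
    sq (G * (G * (V * (H * H))))                      ≡⟨ cong (λ v → sq (G * (G * v))) (double-power h) ⟨
    sq (h ! * (h ! * (h + h) ^ (h + h)))              ∎
    where
    F G H V : ℕ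
    F = (h + h) !
    G = h !
    H = h ^ h
    V = 4 ^ h
    rearrange₁ : ∀ F H h → (F * H * H) * (F * H * H) * h ≡ (H * H * (H * H)) * (F * F * h)
    rearrange₁ = solve-∀
    rearrange₂ : ∀ H G V → (H * H * (H * H)) * (G * G * (G * G) * (V * V)) ≡ (G * (G * (V * (H * H)))) * (G * (G * (V * (H * H))))
    rearrange₂ = solve-∀

  -- The general case k = h + t reduces to the balanced one by monotonicity of the ratio in k.
  binomial-mode : ∀ h t → sq ((h + (h + t)) ! * (h + t) ^ (h + t) * h ^ h) * h ≤ sq (h ! * ((h + t) ! * (h + (h + t)) ^ (h + (h + t))))
  binomial-mode h t = *-cancelˡ-≤-pos (sq (denominator h)) (*-mono-≤ (denominator-pos h) (denominator-pos h)) (begin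
    sq (denominator h) * (sq (numerator k * H) * h)        ≡⟨ rearrange₁ (denominator h) (numerator k) H h ⟩
    sq (numerator k * denominator h) * (H * H * h)         ≤⟨ *-monoˡ-≤ (H * H * h) (sq-mono (ratio-mono t)) ⟩
    sq (numerator h * denominator k) * (H * H * h)         ≡⟨ rearrange₂ (numerator h) (denominator k) H h ⟩
    sq (denominator k) * (sq (numerator h * H) * h)        ≤⟨ *-monoʳ-≤ (sq (denominator k)) (binomial-mode-balanced h) ⟩
    sq (denominator k) * sq (G * denominator h)            ≡⟨ rearrange₃ (denominator k) G (denominator h) ⟩
    sq (denominator h) * sq (G * denominator k)            ∎)
    where
    open BinomialRatio h
    k H G : ℕ
    k = h + t
    H = h ^ h
    G = h !
    rearrange₁ : ∀ B A H h → B * B * ((A * H) * (A * H) * h) ≡ (A * B) * (A * B) * (H * H * h)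
    rearrange₁ = solve-∀
    rearrange₂ : ∀ A B H h → (A * B) * (A * B) * (H * H * h) ≡ B * B * ((A * H) * (A * H) * h)
    rearrange₂ = solve-∀
    rearrange₃ : ∀ B G C → B * B * ((G * C) * (G * C)) ≡ C * C * ((G * B) * (G * B))
    rearrange₃ = solve-∀

  power-product-bound : ∀ c d h k → 0 < h → h ≤ k →
    sq (c ^ h * d ^ k * (h + k) !) * h ≤ sq ((c + d) ^ (h + k)) * sq (h ! * k !)
  power-product-bound c d h k 0<h h≤k with m≤n⇒∃[o]m+o≡n h≤k
  ... | t , refl = *-cancelˡ-≤-pos (sq AA) (*-mono-≤ (n^n-pos a) (n^n-pos a)) (begin
    sq AA * (sq (X * F) * h)          ≡⟨ rearrange₁ AA X F h ⟩
    sq (X * AA) * (sq F * h)          ≤⟨ *-monoˡ-≤ (sq F * h) (sq-mono (weighted-am-gm h k c d 0<h (≤-trans 0<h h≤k))) ⟩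
    sq (CD * HH * KK) * (sq F * h)    ≡⟨ rearrange₂ CD HH KK F h ⟩
    sq CD * (sq (F * KK * HH) * h)    ≤⟨ *-monoʳ-≤ (sq CD) (binomial-mode h t) ⟩
    sq CD * sq (G * (K * AA))         ≡⟨ rearrange₃ CD G K AA ⟩
    sq AA * (sq CD * sq (G * K))      ∎)
    where
    a X AA CD HH KK F G K : ℕ
    a = h + k
    X = c ^ h * d ^ k
    AA = a ^ a
    CD = (c + d) ^ a
    HH = h ^ h
    KK = k ^ k
    F = a !
    G = h !
    K = k !
    rearrange₁ : ∀ AA X F h → AA * AA * ((X * F) * (X * F) * h) ≡ (X * AA) * (X * AA) * (F * F * h)
    rearrange₁ = solve-∀
    rearrange₂ : ∀ CD HH KK F h → (CD * HH * KK) * (CD * HH * KK) * (F * F * h) ≡ CD * CD * ((F * KK * HH) * (F * KK * HH) * h)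
    rearrange₂ = solve-∀
    rearrange₃ : ∀ CD G K AA → CD * CD * ((G * (K * AA)) * (G * (K * AA))) ≡ AA * AA * (CD * CD * ((G * K) * (G * K)))
    rearrange₃ = solve-∀

  x*0≤y : ∀ x {y} → x * 0 ≤ y
  x*0≤y x {y} = subst (_≤ y) (sym (*-zeroʳ x)) z≤n

  power-product-bound-min : ∀ c d h k → sq (c ^ h * d ^ k * (h + k) !) * (h ⊓ k) ≤ sq ((c + d) ^ (h + k)) * sq (h ! * k !)
  power-product-bound-min c d zero    k       = x*0≤y (sq (c ^ 0 * d ^ k * (0 + k) !))
  power-product-bound-min c d (suc h) zero    = x*0≤y (sq (c ^ suc h * d ^ 0 * (suc h + 0) !))
  power-product-bound-min c d (suc h) (suc k) with ≤-total (suc h) (suc k)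
  ... | inj₁ h≤k rewrite m≤n⇒m⊓n≡m h≤k = power-product-bound c d (suc h) (suc k) (s≤s z≤n) h≤k
  ... | inj₂ k≤h rewrite m≥n⇒m⊓n≡n k≤h = subst₂ _≤_
          (cong (λ v → sq v * suc k) (cong₂ _*_ (*-comm (d ^ suc k) (c ^ suc h)) (cong _! (+-comm (suc k) (suc h)))))
          (cong₂ (λ u v → sq u * sq v) (cong₂ _^_ (+-comm d c) (+-comm (suc k) (suc h))) (*-comm (suc k !) (suc h !)))
          (power-product-bound d c (suc k) (suc h) (s≤s z≤n) k≤h)

  c!≤cʰ[c∸h]! : ∀ c h → h ≤ c → c ! ≤ c ^ h * (c ∸ h) !
  c!≤cʰ[c∸h]! c zero _ = ≤-reflexive (sym (*-identityˡ (c !)))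
  c!≤cʰ[c∸h]! (suc c) (suc h) (s≤s h≤c) = begin
    suc c !                                  ≤⟨ c!≤cʰ[c∸h]! (suc c) h (m≤n⇒m≤1+n h≤c) ⟩
    suc c ^ h * (suc c ∸ h) !                ≡⟨ cong (λ v → suc c ^ h * v !) (+-∸-assoc 1 h≤c) ⟩
    suc c ^ h * (suc (c ∸ h) * (c ∸ h) !)    ≤⟨ *-monoʳ-≤ (suc c ^ h) (*-monoˡ-≤ ((c ∸ h) !) (s≤s (m∸n≤m c h))) ⟩
    suc c ^ h * (suc c * (c ∸ h) !)          ≡⟨ rearrange (suc c ^ h) (suc c) ((c ∸ h) !) ⟩
    suc c * suc c ^ h * (c ∸ h) !            ∎
    where
    rearrange : ∀ x y z → x * (y * z) ≡ y * x * z
    rearrange = solve-∀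

  -- The numerical heart of the count: for h ≤ c, k ≤ d and c + d ≤ n,
  --   binom(c,h) binom(d,k) (h+k)! · √(min(h,k)) ≤ n^(h+k),
  -- written with factorials and squared.
  binomial-product-bound : ∀ c d h k n → h ≤ c → k ≤ d → c + d ≤ n →
    sq (c ! * d ! * (h + k) !) * (h ⊓ k) ≤ sq (n ^ (h + k)) * sq ((h ! * (c ∸ h) !) * (k ! * (d ∸ k) !))
  binomial-product-bound c d h k n h≤c k≤d c+d≤n = begin
    sq (c ! * d ! * (h + k) !) * m
      ≤⟨ *-monoˡ-≤ m (sq-mono (*-monoˡ-≤ ((h + k) !) (*-mono-≤ (c!≤cʰ[c∸h]! c h h≤c) (c!≤cʰ[c∸h]! d k k≤d)))) ⟩
    sq (c ^ h * Fc * (d ^ k * Fd) * (h + k) !) * m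
      ≡⟨ rearrange₁ (c ^ h) Fc (d ^ k) Fd ((h + k) !) m ⟩
    sq (Fc * Fd) * (sq (c ^ h * d ^ k * (h + k) !) * m)
      ≤⟨ *-monoʳ-≤ (sq (Fc * Fd)) (power-product-bound-min c d h k) ⟩
    sq (Fc * Fd) * (sq ((c + d) ^ (h + k)) * sq (h ! * k !))
      ≤⟨ *-monoʳ-≤ (sq (Fc * Fd)) (*-monoˡ-≤ (sq (h ! * k !)) (sq-mono (^-monoˡ-≤ (h + k) c+d≤n))) ⟩
    sq (Fc * Fd) * (sq (n ^ (h + k)) * sq (h ! * k !))
      ≡⟨ rearrange₂ Fc Fd (n ^ (h + k)) (h !) (k !) ⟩
    sq (n ^ (h + k)) * sq ((h ! * Fc) * (k ! * Fd)) ∎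
    where
    m Fc Fd : ℕ
    m = h ⊓ k
    Fc = (c ∸ h) !
    Fd = (d ∸ k) !
    rearrange₁ : ∀ ch Fc dk Fd A m → (ch * Fc * (dk * Fd) * A) * (ch * Fc * (dk * Fd) * A) * m ≡ (Fc * Fd) * (Fc * Fd) * ((ch * dk * A) * (ch * dk * A) * m)
    rearrange₁ = solve-∀
    rearrange₂ : ∀ Fc Fd N H K → (Fc * Fd) * (Fc * Fd) * (N * N * ((H * K) * (H * K))) ≡ N * N * ((H * Fc) * (K * Fd) * ((H * Fc) * (K * Fd)))
    rearrange₂ = solve-∀

  cancel-weight : ∀ L w P F m N → 0 < w → L * w ≤ P → sq (P * F) * m ≤ sq N * sq w → sq (L * F) * m ≤ sq N
  cancel-weight L w P F m N 0<w Lw≤P bound = *-cancelˡ-≤-pos (sq w) (*-mono-≤ 0<w 0<w) (begin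
    sq w * (sq (L * F) * m)    ≡⟨ rearrange w L F m ⟩
    sq (L * w * F) * m         ≤⟨ *-monoˡ-≤ m (sq-mono (*-monoˡ-≤ F Lw≤P)) ⟩
    sq (P * F) * m             ≤⟨ bound ⟩
    sq N * sq w                ≡⟨ *-comm (sq N) (sq w) ⟩
    sq w * sq N                ∎)
    where
    rearrange : ∀ w L F m → (w * w) * ((L * F) * (L * F) * m) ≡ (L * w * F) * (L * w * F) * m
    rearrange = solve-∀

  fourth-power-bound : ∀ X m N r → sq X * m ≤ sq N → X ^ 4 * (16 * r * (m * m)) ≤ 16 * r * sq (sq N)
  fourth-power-bound X m N r bound = subst₂ _≤_ (rearrange X m (16 * r)) (*-comm (sq (sq N)) (16 * r))
    (*-monoˡ-≤ (16 * r) (sq-mono bound))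
    where
    rearrange : ∀ X m R → (X * X * m) * (X * X * m) * R ≡ X * (X * (X * (X * 1))) * (R * (m * m))
    rearrange = solve-∀

  n^4a≡ : ∀ n a → n ^ (4 * a) ≡ sq (sq (n ^ a))
  n^4a≡ n a = trans (cong (n ^_) (*-comm 4 a)) (trans (sym (^-*-assoc n a 4)) (fourth (n ^ a)))
    where
    fourth : ∀ x → x * (x * (x * (x * 1))) ≡ (x * x) * (x * x)
    fourth = solve-∀

open Estimates

does-true⇒ : ∀ {p} {P : Set p} (P? : Dec P) → does P? ≡ true → P
does-true⇒ (yes p) _ = p
does-true⇒ (no _) ()

module Decomposition {n} (G : Hypergraph n) (B : Subset n) where

  C : Subset n
  C = tabulate (λ v → does (connectedTo? G B v))

  D : Subset n
  D = ∁ (B ∪ C)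

  S : Subset n → Subset n
  S A = A ∩ C

  T : Subset n → Subset n
  T A = A ─ (B ∪ C)

  ∈C⁺ : ∀ {v} → ConnectedTo G B v → v ∈ C
  ∈C⁺ {v} c = lookup⇒[]= v C (trans (lookup∘tabulate _ v) (dec-true (connectedTo? G B v) c))

  ∈C⁻ : ∀ {v} → v ∈ C → ConnectedTo G B v
  ∈C⁻ {v} v∈C = does-true⇒ (connectedTo? G B v) (trans (sym (lookup∘tabulate _ v)) ([]=⇒lookup v∈C))

  C∩B-empty : ∀ {v} → v ∈ C → v ∉ B
  C∩B-empty = proj₁ ∘ ∈C⁻

  S⊆C : ∀ A → S A ⊆ C
  S⊆C A = proj₂ ∘ x∈p∩q⁻ A C

  T⁺ : ∀ {A v} → v ∈ A → v ∉ B → v ∉ C → v ∈ T A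
  T⁺ v∈A v∉B v∉C = x∈p∧x∉q⇒x∈p─q v∈A ([ v∉B , v∉C ] ∘ x∈p∪q⁻ B C)

  T⊆D : ∀ A → T A ⊆ D
  T⊆D A = x∉p⇒x∈∁p ∘ x∈p─q⇒x∉q A (B ∪ C)

  h≡∣S∣ : ∀ A → hFun G A B ≡ ∣ S A ∣
  h≡∣S∣ A = trans (cong length (filter-≐ _ (_∈? S A) (to , from) (allFin n))) (sym (size≡count (S A)))
    where
    to : ∀ {v} → v ∈ A ─ B × ConnectedTo G B v → v ∈ S A
    to (v∈A─B , c) = x∈p∩q⁺ (p─q⊆p A B v∈A─B , ∈C⁺ c)
    from : ∀ {v} → v ∈ S A → v ∈ A ─ B × ConnectedTo G B v
    from v∈S = let (v∈A , v∈C) = x∈p∩q⁻ A C v∈S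
               in x∈p∧x∉q⇒x∈p─q v∈A (C∩B-empty v∈C) , ∈C⁻ v∈C

  size-A─B : ∀ A → ∣ A ─ B ∣ ≡ ∣ S A ∣ + ∣ T A ∣
  size-A─B A = size-partition S⊆A─B T⊆A─B split
    (λ v∈S v∈T → x∈p─q⇒x∉q A (B ∪ C) v∈T (x∈p∪q⁺ (inj₂ (S⊆C A v∈S))))
    where
    S⊆A─B : S A ⊆ A ─ B
    S⊆A─B v∈S = let (v∈A , v∈C) = x∈p∩q⁻ A C v∈S in x∈p∧x∉q⇒x∈p─q v∈A (C∩B-empty v∈C)
    T⊆A─B : T A ⊆ A ─ B
    T⊆A─B v∈T = x∈p∧x∉q⇒x∈p─q (p─q⊆p A (B ∪ C) v∈T) (λ v∈B → x∈p─q⇒x∉q A (B ∪ C) v∈T (x∈p∪q⁺ (inj₁ v∈B)))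
    split : ∀ {v} → v ∈ A ─ B → v ∈ S A ⊎ v ∈ T A
    split {v} v∈A─B with v ∈? C
    ... | yes v∈C = inj₁ (x∈p∩q⁺ (p─q⊆p A B v∈A─B , v∈C))
    ... | no  v∉C = inj₂ (T⁺ (p─q⊆p A B v∈A─B) (x∈p─q⇒x∉q A B v∈A─B) v∉C)

  size-decomposition : ∀ {A} → B ⊆ A → ∣ A ∣ ≡ ∣ B ∣ + (∣ S A ∣ + ∣ T A ∣)
  size-decomposition {A} B⊆A =
    trans (size-partition B⊆A (p─q⊆p A B) split (λ v∈B v∈A─B → x∈p─q⇒x∉q A B v∈A─B v∈B))
          (cong (∣ B ∣ +_) (size-A─B A))
    where
    split : ∀ {v} → v ∈ A → v ∈ B ⊎ v ∈ A ─ B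
    split {v} v∈A with v ∈? B
    ... | yes v∈B = inj₁ v∈B
    ... | no  v∉B = inj₂ (x∈p∧x∉q⇒x∈p─q v∈A v∉B)

  ∣C∣+∣D∣≤n : ∣ C ∣ + ∣ D ∣ ≤ n
  ∣C∣+∣D∣≤n = begin
    ∣ C ∣ + ∣ D ∣                  ≡⟨ cong (∣ C ∣ +_) (∣∁p∣≡n∸∣p∣ (B ∪ C)) ⟩
    ∣ C ∣ + (n ∸ ∣ B ∪ C ∣)        ≤⟨ +-monoˡ-≤ (n ∸ ∣ B ∪ C ∣) (∣q∣≤∣p∪q∣ B C) ⟩
    ∣ B ∪ C ∣ + (n ∸ ∣ B ∪ C ∣)    ≡⟨ m+[n∸m]≡n (∣p∣≤n (B ∪ C)) ⟩
    n                              ∎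
    where open ≤-Reasoning

  decomposition-injective : ∀ {A A′} → B ⊆ A → B ⊆ A′ → (S A , T A) ≡ (S A′ , T A′) → A ≡ A′
  decomposition-injective B⊆A B⊆A′ eq = ⊆-antisym (parts-⊆ B⊆A′ eq) (parts-⊆ B⊆A (sym eq))
    where
    parts-⊆ : ∀ {A A′} → B ⊆ A′ → (S A , T A) ≡ (S A′ , T A′) → A ⊆ A′
    parts-⊆ {A} {A′} B⊆A′ eq {v} v∈A with v ∈? B | v ∈? C
    ... | yes v∈B | _       = B⊆A′ v∈B
    ... | no  v∉B | yes v∈C = proj₁ (x∈p∩q⁻ A′ C (subst (v ∈_) (cong proj₁ eq) (x∈p∩q⁺ (v∈A , v∈C))))
    ... | no  v∉B | no  v∉C = p─q⊆p A′ (B ∪ C) (subst (v ∈_) (cong proj₂ eq) (T⁺ v∈A v∉B v∉C))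

  edge⊆ : ∀ {A e v} → B ⊆ A → v ∈ A → e ─ ⁅ v ⁆ ⊆ B → e ⊆ A
  edge⊆ {v = v} B⊆A v∈A e-v⊆B {u} u∈e with u ≟ᶠ v
  ... | yes refl = v∈A
  ... | no  u≢v  = B⊆A (e-v⊆B (x∈p∧x≢y⇒x∈p-y u∈e u≢v))

  connected⇒non-isolated : ∀ {A v} → B ⊆ A → v ∈ A → ConnectedTo G B v → NonIsolatedIn G A v
  connected⇒non-isolated B⊆A v∈A (_ , has-edge) =
    let (e , e∈G , v∈e , e-v⊆B) = find has-edge in lose e∈G (edge⊆ B⊆A v∈A e-v⊆B , v∈e)

  -- f(A, B) = 0 means m(A, B) = h(A, B); as connected vertices are non-isolated, every
  -- non-isolated vertex of A ∖ B is then connected to B.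
  f≡0⇒connected : ∀ {A v} → B ⊆ A → fFun G A B ≡ ℤ.+ 0 → v ∈ A ─ B → NonIsolatedIn G A v → ConnectedTo G B v
  f≡0⇒connected {A} {v} B⊆A f≡0 v∈A─B non-isolated with connectedTo? G B v
  ... | yes c = c
  ... | no ¬c = ⊥-elim (<-irrefl (sym m≡h) (count-strict
          (λ v → (v ∈? (A ─ B)) ×-dec connectedTo? G B v) (λ v → (v ∈? (A ─ B)) ×-dec nonIsolatedIn? G A v)
          (allFin n) (λ _ (v∈A─B , c) → v∈A─B , connected⇒non-isolated B⊆A (p─q⊆p A B v∈A─B) c)
          (∈-allFin v) (v∈A─B , non-isolated) (¬c ∘ proj₂)))
    where
    m≡h : mFun G A B ≡ hFun G A B
    m≡h = ℤₚ.+-injective (ℤₚ.i-j≡0⇒i≡j _ _ f≡0)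

  edge-inside : ∀ {A e} → B ⊆ A → fFun G A B ≡ ℤ.+ 0 → e ∈ₗ edges G → e ⊆ A → ∀ {u} → u ∈ e → u ∈ B ⊎ u ∈ S A
  edge-inside {A} B⊆A f≡0 e∈G e⊆A {u} u∈e with u ∈? B
  ... | yes u∈B = inj₁ u∈B
  ... | no  u∉B = inj₂ (x∈p∩q⁺ (e⊆A u∈e , ∈C⁺ (f≡0⇒connected B⊆A f≡0 (x∈p∧x∉q⇒x∈p─q (e⊆A u∈e) u∉B) (lose e∈G (e⊆A , u∈e)))))

  -- With e(A) = e(A′), the connected parts of pleasant-like sets form an antichain: a connected
  -- vertex of A′ outside A would give an edge of A′ that is not an edge of A, while every edge
  -- of A is one of A′.
  S-antichain : ∀ {A A′} → B ⊆ A → B ⊆ A′ → fFun G A B ≡ ℤ.+ 0 → eCount G A ≡ eCount G A′ → S A ⊆ S A′ → S A ≡ S A′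
  S-antichain {A} {A′} B⊆A B⊆A′ f≡0 e≡e′ S⊆S′ = ⊆-antisym S⊆S′ S′⊆S
    where
    S′⊆S : S A′ ⊆ S A
    S′⊆S {v} v∈S′ with v ∈? S A
    ... | yes v∈S = v∈S
    ... | no  v∉S = let (v∈A′ , v∈C) = x∈p∩q⁻ A′ C v∈S′ in ⊥-elim (<-irrefl e≡e′ (new-edge v∈A′ (∈C⁻ v∈C)))
      where
      edge-of-A′ : ∀ {e} → e ∈ₗ edges G → e ⊆ A → e ⊆ A′
      edge-of-A′ e∈G e⊆A u∈e = [ B⊆A′ , proj₁ ∘ x∈p∩q⁻ A′ C ∘ S⊆S′ ] (edge-inside B⊆A f≡0 e∈G e⊆A u∈e)
      new-edge : v ∈ A′ → ConnectedTo G B v → eCount G A < eCount G A′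
      new-edge v∈A′ connected@(_ , has-edge) =
        let (e , e∈G , v∈e , e-v⊆B) = find has-edge
        in count-strict (_⊆? A) (_⊆? A′) (edges G) edge-of-A′ e∈G (edge⊆ B⊆A′ v∈A′ e-v⊆B)
             (λ e⊆A → v∉S (x∈p∩q⁺ (e⊆A v∈e , ∈C⁺ connected)))

  T-antichain : ∀ {A A′} → B ⊆ A → B ⊆ A′ → ∣ A ∣ ≡ ∣ A′ ∣ → S A ≡ S A′ → T A ⊆ T A′ → T A ≡ T A′
  T-antichain {A} {A′} B⊆A B⊆A′ ∣A∣≡∣A′∣ S≡S′ T⊆T′ = ⊆-size-eq T⊆T′ (+-cancelˡ-≡ ∣ S A ∣ _ _ (+-cancelˡ-≡ ∣ B ∣ _ _ (begin
    ∣ B ∣ + (∣ S A ∣ + ∣ T A ∣)     ≡⟨ size-decomposition B⊆A ⟨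
    ∣ A ∣                          ≡⟨ ∣A∣≡∣A′∣ ⟩
    ∣ A′ ∣                         ≡⟨ size-decomposition B⊆A′ ⟩
    ∣ B ∣ + (∣ S A′ ∣ + ∣ T A′ ∣)   ≡⟨ cong (λ s → ∣ B ∣ + (∣ s ∣ + ∣ T A′ ∣)) S≡S′ ⟨
    ∣ B ∣ + (∣ S A ∣ + ∣ T A′ ∣)    ∎)))
    where open ≡-Reasoning

ℕ→ℚ≡mkℚ : ∀ m → ℕ→ℚ m ≡ ℚ.mkℚ (ℤ.+ m) 0 (coprime-sym (1-coprimeTo m))
ℕ→ℚ≡mkℚ m = ℚₚ.normalize-coprime (coprime-sym (1-coprimeTo m))

ℕ→ℚ-* : ∀ a b → ℕ→ℚ a ℚ.* ℕ→ℚ b ≡ ℕ→ℚ (a * b)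
ℕ→ℚ-* a b rewrite ℕ→ℚ≡mkℚ a | ℕ→ℚ≡mkℚ b = cong (ℚ._/ 1) (sym (ℤₚ.pos-* a b))

ℕ→ℚ-mono : ∀ {a b} → a ≤ b → ℕ→ℚ a ℚ.≤ ℕ→ℚ b
ℕ→ℚ-mono {a} {b} a≤b rewrite ℕ→ℚ≡mkℚ a | ℕ→ℚ≡mkℚ b =
  ℚ.*≤* (subst₂ ℤ._≤_ (sym (ℤₚ.*-identityʳ (ℤ.+ a))) (sym (ℤₚ.*-identityʳ (ℤ.+ b))) (ℤ.+≤+ a≤b))

ℕ→ℚ-nonNegative : ∀ a → ℚ.NonNegative (ℕ→ℚ a)
ℕ→ℚ-nonNegative a rewrite ℕ→ℚ≡mkℚ a = _

quarter-eps-ℕ : ∀ {r k ε} x → AtLeastQuarterEps r k ε (ℕ→ℚ x) → ε ℚ.* ε ℚ.* ℕ→ℚ k ℚ.≤ ℕ→ℚ (16 * r * (x * x))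
quarter-eps-ℕ {r} x (_ , bound) =
  ℚₚ.≤-trans bound (ℚₚ.≤-reflexive (trans (cong₂ ℚ._*_ (ℕ→ℚ-* 16 r) (ℕ→ℚ-* x x)) (ℕ→ℚ-* (16 * r) (x * x))))

quarter-eps-min : ∀ {r k ε} x y → AtLeastQuarterEps r k ε (ℕ→ℚ x) → AtLeastQuarterEps r k ε (ℕ→ℚ y) →
  ε ℚ.* ε ℚ.* ℕ→ℚ k ℚ.≤ ℕ→ℚ (16 * r * ((x ⊓ y) * (x ⊓ y)))
quarter-eps-min {r} {k} {ε} x y qx qy with ≤-total x y
... | inj₁ x≤y rewrite m≤n⇒m⊓n≡m x≤y = quarter-eps-ℕ {r} {k} {ε} x qx
... | inj₂ y≤x rewrite m≥n⇒m⊓n≡n y≤x = quarter-eps-ℕ {r} {k} {ε} y qy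

scale-bound : ∀ (ε : ℚ) k X Y Z → ε ℚ.* ε ℚ.* ℕ→ℚ k ℚ.≤ ℕ→ℚ Y → X * Y ≤ Z →
  ℕ→ℚ X ℚ.* (ε ℚ.* ε) ℚ.* ℕ→ℚ k ℚ.≤ ℕ→ℚ Z
scale-bound ε k X Y Z εk≤Y XY≤Z = begin
  ℕ→ℚ X ℚ.* (ε ℚ.* ε) ℚ.* ℕ→ℚ k   ≡⟨ ℚₚ.*-assoc (ℕ→ℚ X) (ε ℚ.* ε) (ℕ→ℚ k) ⟩
  ℕ→ℚ X ℚ.* (ε ℚ.* ε ℚ.* ℕ→ℚ k)   ≤⟨ ℚₚ.*-monoˡ-≤-nonNeg (ℕ→ℚ X) ⦃ ℕ→ℚ-nonNegative X ⦄ εk≤Y ⟩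
  ℕ→ℚ X ℚ.* ℕ→ℚ Y                 ≡⟨ ℕ→ℚ-* X Y ⟩
  ℕ→ℚ (X * Y)                     ≤⟨ ℕ→ℚ-mono XY≤Z ⟩
  ℕ→ℚ Z                           ∎
  where open ℚₚ.≤-Reasoning

no-members-bound : ∀ (ε : ℚ) k Z → ℕ→ℚ 0 ℚ.* (ε ℚ.* ε) ℚ.* ℕ→ℚ k ℚ.≤ ℕ→ℚ Z
no-members-bound ε k Z = ℚₚ.≤-trans
  (ℚₚ.≤-reflexive (trans (cong (ℚ._* ℕ→ℚ k) (ℚₚ.*-zeroˡ (ε ℚ.* ε))) (ℚₚ.*-zeroˡ (ℕ→ℚ k)))) (ℕ→ℚ-mono {0} {Z} z≤n)

module Pleasant-components {n} {G : Hypergraph n} {k ℓ r ε} {A B : Subset n} (p : Pleasant G k ℓ r ε A B) where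

  B⊆A : B ⊆ A
  B⊆A = proj₁ p

  size : ∣ A ∣ ≡ k
  size = proj₁ (proj₂ p)

  edge-count : eCount G A ≡ ℓ
  edge-count = proj₁ (proj₂ (proj₂ p))

  f≡0 : fFun G A B ≡ ℤ.+ 0
  f≡0 = proj₁ (proj₂ (proj₂ (proj₂ p)))

  h-bound : AtLeastQuarterEps r k ε (ℕ→ℚ (hFun G A B))
  h-bound = proj₁ (proj₂ (proj₂ (proj₂ (proj₂ p))))

  rest-bound : AtLeastQuarterEps r k ε (ℤ→ℚ (ℤ.+ ∣ A ─ B ∣ ℤ.- ℤ.+ hFun G A B))
  rest-bound = proj₂ (proj₂ (proj₂ (proj₂ (proj₂ p))))

module PleasantFamily {n} (G : Hypergraph n) (B : Subset n) (k ℓ r : ℕ) (ε : ℚ) (As : List (Subset n))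
                      (unique : Unique As) (pleasant : All (λ A → Pleasant G k ℓ r ε A B) As) where

  open Decomposition G B
  open module P {A} (A∈As : A ∈ₗ As) = Pleasant-components {G = G} {k} {ℓ} {r} {ε} (All.lookup pleasant A∈As)

  c d : ℕ
  c = ∣ C ∣
  d = ∣ D ∣

  h t : Subset n → ℕ
  h A = ∣ S A ∣
  t A = ∣ T A ∣

  weight : Subset n → ℕ
  weight A = chains c (S A) * chains d (T A)

  total-weight : sum (map weight As) ≤ c ! * d !
  total-weight = subst (_≤ c ! * d !) (cong sum (sym (map-∘ As)))
    (product-LYM c d C D refl refl (map parts As) parts-unique
      (All.map⁺ (All.tabulate (λ {A} _ → S⊆C A , T⊆D A))) S-family-antichain T-family-antichain)
    where
    parts : Subset n → Subset n × Subset n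
    parts A = S A , T A
    parts-unique : Unique (map parts As)
    parts-unique = unique-map parts unique (λ m m′ → decomposition-injective (B⊆A m) (B⊆A m′))
    S-family-antichain : ∀ {P Q} → P ∈ₗ map parts As → Q ∈ₗ map parts As → proj₁ P ⊆ proj₁ Q → proj₁ P ≡ proj₁ Q
    S-family-antichain m m′ with ∈-map⁻ parts m | ∈-map⁻ parts m′
    ... | A , mA , refl | A′ , mA′ , refl = S-antichain (B⊆A mA) (B⊆A mA′) (f≡0 mA) (trans (edge-count mA) (sym (edge-count mA′)))
    T-family-antichain : ∀ {P Q} → P ∈ₗ map parts As → Q ∈ₗ map parts As → proj₁ P ≡ proj₁ Q → proj₂ P ⊆ proj₂ Q → proj₂ P ≡ proj₂ Q
    T-family-antichain m m′ with ∈-map⁻ parts m | ∈-map⁻ parts m′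
    ... | A , mA , refl | A′ , mA′ , refl = T-antichain (B⊆A mA) (B⊆A mA′) (trans (size mA) (sym (size mA′)))

  parts-size : ∀ {A} → A ∈ₗ As → k ∸ ∣ B ∣ ≡ h A + t A
  parts-size m = trans (cong (_∸ ∣ B ∣) (trans (sym (size m)) (size-decomposition (B⊆A m)))) (m+n∸m≡n ∣ B ∣ _)

  weight-pos : ∀ A → 0 < weight A
  weight-pos A = *-mono-≤ (chains-pos c (S A)) (chains-pos d (T A))

  member-estimate : ∀ A → sq (c ! * d ! * (h A + t A) !) * (h A ⊓ t A) ≤ sq (n ^ (h A + t A)) * sq (weight A)
  member-estimate A = binomial-product-bound c d (h A) (t A) n (p⊆q⇒∣p∣≤∣q∣ (S⊆C A)) (p⊆q⇒∣p∣≤∣q∣ (T⊆D A)) ∣C∣+∣D∣≤n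

  -- For a member A of least weight, L · weight A ≤ |C|! |D|!; dividing the member estimate by
  -- weight A gives, with a = k - |B| = h A + t A,   (L · a!)² · min(h A, t A) ≤ (nᵃ)².
  least-member-bound : ∀ {A} → A ∈ₗ As → (∀ {A′} → A′ ∈ₗ As → weight A ≤ weight A′) →
    sq (length As * (k ∸ ∣ B ∣) !) * (h A ⊓ t A) ≤ sq (n ^ (k ∸ ∣ B ∣))
  least-member-bound {A} A∈As least =
    subst (λ a → sq (length As * a !) * (h A ⊓ t A) ≤ sq (n ^ a)) (sym (parts-size A∈As))
      (cancel-weight (length As) (weight A) (c ! * d !) ((h A + t A) !) (h A ⊓ t A) (n ^ (h A + t A))
        (weight-pos A) (≤-trans (length*least≤sum weight As least) total-weight) (member-estimate A))

  ε-bound : ∀ {A} → A ∈ₗ As → ε ℚ.* ε ℚ.* ℕ→ℚ k ℚ.≤ ℕ→ℚ (16 * r * ((h A ⊓ t A) * (h A ⊓ t A)))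
  ε-bound {A} m = quarter-eps-min {r} {k} {ε} (h A) (t A)
    (subst (λ h → AtLeastQuarterEps r k ε (ℕ→ℚ h)) (h≡∣S∣ A) (h-bound m))
    (subst (AtLeastQuarterEps r k ε ∘ ℤ→ℚ) rest≡∣T∣ (rest-bound m))
    where
    rest≡∣T∣ : ℤ.+ ∣ A ─ B ∣ ℤ.- ℤ.+ hFun G A B ≡ ℤ.+ t A
    rest≡∣T∣ = begin
      ℤ.+ ∣ A ─ B ∣ ℤ.- ℤ.+ hFun G A B      ≡⟨ cong₂ (λ x y → ℤ.+ x ℤ.- ℤ.+ y) (size-A─B A) (h≡∣S∣ A) ⟩
      ℤ.+ (h A + t A) ℤ.- ℤ.+ h A    ≡⟨ ℤₚ.[+m]-[+n]≡m⊖n (h A + t A) (h A) ⟩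
      (h A + t A) ℤ.⊖ h A        ≡⟨ ℤₚ.⊖-≥ (m≤m+n (h A) (t A)) ⟩
      ℤ.+ ((h A + t A) ∸ h A)      ≡⟨ cong ℤ.+_ (m+n∸m≡n (h A) (t A)) ⟩
      ℤ.+ t A                          ∎
      where open ≡-Reasoning

-- It follows from the bound for a member of
-- least weight and the pleasantness bound ε² k ≤ 16 r min(h, t)².
lemma4p2 : (r k ℓ n : ℕ) → 0 < r → 0 < k → 0 < ℓ → k ≤ n →
  (G : Hypergraph n) → EdgesAtMost r G →
  (ε : ℚ) → 0ℚ Data.Rational.< ε → ε Data.Rational.< ½ →
  (B : Subset n) → ∣ B ∣ ≤ k →
  (As : List (Subset n)) → Unique As → All (λ A → Pleasant G k ℓ r ε A B) As →
  BoundHolds (length As) r k n (k ∸ ∣ B ∣) ε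
lemma4p2 r k ℓ n _ _ _ _ G _ ε _ _ B _ [] _ _ = no-members-bound ε k (16 * r * n ^ (4 * (k ∸ ∣ B ∣)))
lemma4p2 r k ℓ n _ _ _ _ G _ ε _ _ B _ As@(A₀ ∷ As′) unique pleasant =
  scale-bound ε k ((L * a !) ^ 4) (16 * r * (m * m)) (16 * r * n ^ (4 * a)) (ε-bound A*∈As) count-bound
  where
  open PleasantFamily G B k ℓ r ε As unique pleasant
  A* : Subset n
  A* = proj₁ (least-member weight A₀ As′)
  A*∈As : A* ∈ₗ As
  A*∈As = proj₁ (proj₂ (least-member weight A₀ As′))
  L a m : ℕ
  L = length As
  a = k ∸ ∣ B ∣
  m = h A* ⊓ t A*
  count-bound : (L * a !) ^ 4 * (16 * r * (m * m)) ≤ 16 * r * n ^ (4 * a)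
  count-bound = subst ((L * a !) ^ 4 * (16 * r * (m * m)) ≤_) (cong (16 * r *_) (sym (n^4a≡ n a)))
    (fourth-power-bound (L * a !) m (n ^ a) r (least-member-bound A*∈As (proj₂ (proj₂ (least-member weight A₀ As′)))))
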